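{- Let $A_0, A_1, \ldots, A_m$ be FDDS and $P(X) = \sum_{i=0}^{m} A_i X^i$. Then $P$ is injective on FDDS (i.e. $P(X)=P(Y)$ implies $X=Y$ for all FDDS $X,Y$) if and only if $A_i$ is cancelable for some $i \ge 1$.
   Context: An FDDS is a pair $(S,f)$ with $S$ a finite (possibly empty) set and $f:S\to S$, up to isomorphism; sum is disjoint union, product is the direct product $(S,f)\times(T,g)=(S\times T,(s,t)\mapsto(f(s),g(t)))$, and $X^0$ is the one-state FDDS with a fixed point. An FDDS $A$ is cancelable if $AB=AC$ implies $B=C$ for all FDDS $B,C$ (equivalently, some connected component of $A$ contains a fixed point). -}

module Defs where

open import Data.Nat using (ℕ; zero; suc; _+_; _*_; _≥_)
open import Data.Fin using (Fin; toℕ; splitAt; join; remQuot; combine)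
open import Data.Sum using (_⊎_; inj₁; inj₂; [_,_]′)
open import Data.Product using (Σ; _×_; _,_; proj₁; proj₂)
open import Relation.Binary.PropositionalEquality using (_≡_)
open import Function using (_∘_)

record FDDS : Set where
  constructor mkFDDS
  field
    size : ℕ
    step : Fin size → Fin size
open FDDS public

record _≅_ (A B : FDDS) : Set where
  field
    to      : Fin (size A) → Fin (size B)
    from    : Fin (size B) → Fin (size A)
    from-to : ∀ x → from (to x) ≡ x
    to-from : ∀ y → to (from y) ≡ y
    commute : ∀ x → to (step A x) ≡ step B (to x)
infix 4 _≅_

𝟘 : FDDS
𝟘 = mkFDDS 0 (λ ())

𝟙 : FDDS
𝟙 = mkFDDS 1 (λ x → x)

_⊕_ : FDDS → FDDS → FDDS
A ⊕ B = mkFDDS (size A + size B)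
  (λ x → join (size A) (size B)
     ([ (λ a → inj₁ (step A a)) , (λ b → inj₂ (step B b)) ]′ (splitAt (size A) x)))
infixl 6 _⊕_

_⊗_ : FDDS → FDDS → FDDS
A ⊗ B = mkFDDS (size A * size B)
  (λ x → let p = remQuot {size A} (size B) x
         in combine (step A (proj₁ p)) (step B (proj₂ p)))
infixl 7 _⊗_

_^_ : FDDS → ℕ → FDDS
X ^ zero  = 𝟙
X ^ suc k = (X ^ k) ⊗ X

∑ : (n : ℕ) → (Fin n → FDDS) → FDDS
∑ zero    F = 𝟘
∑ (suc n) F = F Fin.zero ⊕ ∑ n (F ∘ Fin.suc)

evalPoly : (m : ℕ) → (Fin (suc m) → FDDS) → FDDS → FDDS
evalPoly m A X = ∑ (suc m) (λ i → A i ⊗ (X ^ toℕ i))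

Cancelable : FDDS → Set
Cancelable A = ∀ (B C : FDDS) → A ⊗ B ≅ A ⊗ C → B ≅ C

PolyInjective : (m : ℕ) → (Fin (suc m) → FDDS) → Set
PolyInjective m A = ∀ (X Y : FDDS) → evalPoly m A X ≅ evalPoly m A Y → X ≅ Y

{-# OPTIONS --safe #-}

-- Everything is detected by counting homomorphisms: hom G Z is the number of maps G → Z commuting
-- with the dynamics.  Sorting the homs G → X by kernel, all but the injective ones factor through a
-- strictly smaller quotient of G, so by induction on G the counts hom G X = hom G Y for all G give
-- injections X → Y and Y → X, hence X ≅ Y (Lovász).  Every system is a sum of connected ones, so
-- it suffices to compare connected G, and for those hom G turns ⊕ and ⊗ into + and *.
--
-- If Aᵢ has a fixed point then hom G Aᵢ ≥ 1, so Aᵢ is cancelable and, when i ≥ 1, hom G (P X) is a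
-- strictly increasing function of hom G X, making P injective.  If no Aᵢ with i ≥ 1 has a fixed
-- point, every connected G mapping to Aᵢ maps onto a cycle of some length 2 ≤ L ≤ |Aᵢ|, and then
-- hom G (cycle of length L) = L = hom G (L fixed points).  Splitting the formal product of all
-- (cycle of length L − L fixed points) into positive and negative parts gives X ≇ Y (they differ on
-- G = 𝟙) with P X ≅ P Y and Aᵢ X ≅ Aᵢ Y.  So Aᵢ is cancelable iff it has a fixed point.

module Submission where

open import Defs

open import Axiom.UniquenessOfIdentityProofs using (module Decidable⇒UIP)
open import Data.Bool using (Bool; true; false; T; not) renaming (_≟_ to _≟ᵇ_)
open import Data.Bool.Properties using (T-irrelevant; not-¬)
open import Data.Empty using (⊥; ⊥-elim)
open import Data.Fin
  using (Fin; zero; suc; toℕ; fromℕ<; punchIn; punchOut; _≟_; _↑ˡ_; _↑ʳ_; join; splitAt; combine; remQuot)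
  renaming (_≤_ to _≤ᶠ_)
open import Data.Fin.Properties
  using ( ¬Fin0; 0↔⊥; 1↔⊤; 2↔Bool; +↔⊎; *↔×; all?; any?; ¬∀⟶∃¬; _≤?_; pigeonhole; injective⇒≤
        ; toℕ-injective; toℕ<n; toℕ-fromℕ<; ↑ˡ-injective; ↑ʳ-injective; punchOut-injective; punchInᵢ≢i
        ; splitAt-↑ˡ; splitAt-↑ʳ; splitAt-join; join-splitAt; remQuot-combine; combine-remQuot)
  renaming (≤-antisym to ≤ᶠ-antisym)
open import Data.Nat as ℕ
  using (ℕ; zero; suc; _+_; _*_; _∸_; _≤_; _<_; _≥_; _<?_; z≤n; s≤s; z<s; NonZero; >-nonZero)
open import Data.Nat.DivMod
  using (_%_; _/_; _mod_; m%n<n; %-distribˡ-+; m%n%n≡m%n; [m+n]%n≡m%n; m<n⇒m%n≡m; n%n≡0; m≡m%n+[m/n]*n)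
open import Data.Nat.Induction using (<-wellFounded)
open import Data.Nat.Properties
  using ( +-0-commutativeMonoid; +-comm; +-assoc; +-identityʳ; +-suc; +-cancelʳ-≡; *-comm; *-zeroʳ
        ; *-cancelˡ-≡; *-cancelʳ-≡; ≤-refl; ≤-trans; ≤-antisym; ≤-pred; <-trans; <-cmp; <⇒≤; <⇒≢; <⇒≱
        ; n<1+n; 1+n≢n; n≢0⇒n>0; m≤m+n; m∸n≤m; m∸n+n≡m; m+[n∸m]≡n; m<n⇒0<n∸m; m≤n⇒m<n∨m≡n
        ; +-mono-≤; +-mono-<-≤; +-mono-≤-<; +-monoʳ-<; *-monoʳ-≤; *-monoʳ-<; ^-monoˡ-≤; ^-monoˡ-<)
open import Algebra.Properties.CommutativeMonoid.Sum +-0-commutativeMonoid using (sum; sum-remove; sum-cong-≗)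
open import Data.Product using (Σ; ∃; _×_; _,_; proj₁; proj₂)
open import Data.Product.Function.Dependent.Propositional using (Σ-↔)
open import Data.Product.Function.NonDependent.Propositional using (_×-↔_)
open import Data.Sum using (_⊎_; inj₁; inj₂; [_,_]′) renaming (map to map⊎)
open import Data.Sum.Function.Propositional using (_⊎-↔_)
open import Data.Sum.Properties using ([,]-cong; [,]-∘; inj₁-injective; inj₂-injective)
open import Data.Unit using (⊤)
open import Data.Vec using (Vec; []; _∷_; lookup; tabulate; allFin)
open import Data.Vec.Functional using (removeAt)
open import Data.Vec.Properties
  using (lookup∘tabulate; tabulate∘lookup; tabulate-cong; lookup-allFin) renaming (≡-dec to ≡-decᵛ)
open import Function using (_∘_; id)
open import Function.Bundles using (_↔_; _⇔_; Inverse; Injection; mk↔ₛ′; mk⇔)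
open import Function.Definitions using (Injective)
open import Function.Properties.Inverse using (↔-refl; ↔-sym; ↔-trans; ↔⇒↣)
open import Induction.WellFounded using (module All)
open import Level using (0ℓ)
open import Relation.Binary.Construct.On as On using ()
open import Relation.Binary.Definitions using (DecidableEquality; tri<; tri≈; tri>)
open import Relation.Binary.PropositionalEquality
  using (_≡_; _≢_; refl; sym; trans; cong; cong₂; subst; module ≡-Reasoning)
open import Relation.Nullary using (Dec; yes; no; ¬_; contradiction; Irrelevant; _×-dec_)
open import Relation.Nullary.Decidable
  using (True; isYes; isYes≗does; toWitness; fromWitness; map′; does-⇔; _→-dec_)

private
  variable
    A B R : Set

-- Finite types

record Finite (A : Set) : Set where
  constructor finite
  field
    card : ℕ
    enum : A ↔ Fin card

  encode : A → Fin card
  encode = Inverse.to enum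

  decode : Fin card → A
  decode = Inverse.from enum

  decode-encode : ∀ a → decode (encode a) ≡ a
  decode-encode = Inverse.strictlyInverseʳ enum

  encode-decode : ∀ i → encode (decode i) ≡ i
  encode-decode = Inverse.strictlyInverseˡ enum

  encode-injective : Injective _≡_ _≡_ encode
  encode-injective = Injection.injective (↔⇒↣ enum)

  decode-injective : Injective _≡_ _≡_ decode
  decode-injective = Injection.injective (↔⇒↣ (↔-sym enum))

open Finite public

↔-finite : Finite A → A ↔ B → Finite B
↔-finite (finite n e) f = finite n (↔-trans (↔-sym f) e)

injective⇒card≤ : (FA : Finite A) (FB : Finite B) {f : A → B} →
                  Injective _≡_ _≡_ f → card FA ≤ card FB
injective⇒card≤ FA FB {f} f-inj =
  injective⇒≤ {f = encode FB ∘ f ∘ decode FA} (decode-injective FA ∘ f-inj ∘ encode-injective FB)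

↔⇒card≡ : (FA : Finite A) (FB : Finite B) → A ↔ B → card FA ≡ card FB
↔⇒card≡ FA FB e = ≤-antisym (injective⇒card≤ FA FB (Injection.injective (↔⇒↣ e)))
                            (injective⇒card≤ FB FA (Injection.injective (↔⇒↣ (↔-sym e))))

injective-nonsurjective⇒card< : ∀ {n} (FA : Finite A) {f : A → Fin n} →
  Injective _≡_ _≡_ f → (y : Fin n) → (∀ a → f a ≢ y) → card FA < n
injective-nonsurjective⇒card< {n = suc n} FA {f} f-inj y missed = s≤s
  (injective⇒card≤ FA (finite n ↔-refl) {f = λ a → punchOut (missed a ∘ sym)}
    (f-inj ∘ punchOut-injective (missed _ ∘ sym) (missed _ ∘ sym)))

inhabited⇒card>0 : (FA : Finite A) → A → 0 < card FA
inhabited⇒card>0 FA a with card FA | encode FA a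
... | suc _ | _ = s≤s z≤n

card>0⇒inhabited : (FA : Finite A) → 0 < card FA → A
card>0⇒inhabited FA 0<n = decode FA (fromℕ< 0<n)

⊥-finite : Finite ⊥
⊥-finite = finite 0 (↔-sym 0↔⊥)

⊤-finite : Finite ⊤
⊤-finite = finite 1 (↔-sym 1↔⊤)

Fin-finite : ∀ n → Finite (Fin n)
Fin-finite n = finite n ↔-refl

Fin1-irrelevant : (x y : Fin 1) → x ≡ y
Fin1-irrelevant zero zero = refl

irrelevant-finite : Irrelevant A → Dec A → Finite A
irrelevant-finite irr (yes a) = finite 1 (mk↔ₛ′ (λ _ → zero) (λ _ → a) (Fin1-irrelevant zero) (irr a))
irrelevant-finite irr (no ¬a) = finite 0 (mk↔ₛ′ (⊥-elim ∘ ¬a) (λ ()) (λ ()) (⊥-elim ∘ ¬a))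

≡ᵇ-irrelevant : {a b : Bool} → Irrelevant (a ≡ b)
≡ᵇ-irrelevant = Decidable⇒UIP.≡-irrelevant _≟ᵇ_

Bool-finite : Finite Bool
Bool-finite = finite 2 (↔-sym 2↔Bool)

T-finite : ∀ b → Finite (T b)
T-finite true  = ⊤-finite
T-finite false = ⊥-finite

empty⇒card≡0 : (FA : Finite A) → ¬ A → card FA ≡ 0
empty⇒card≡0 FA ¬a = ↔⇒card≡ FA ⊥-finite (mk↔ₛ′ ¬a (λ ()) (λ ()) (⊥-elim ∘ ¬a))

contractible⇒card≡1 : (FA : Finite A) (a : A) → (∀ b → b ≡ a) → card FA ≡ 1
contractible⇒card≡1 FA a unique =
  ↔⇒card≡ FA ⊤-finite (mk↔ₛ′ _ (λ _ → a) (λ _ → refl) (sym ∘ unique))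

⊎-finite : Finite A → Finite B → Finite (A ⊎ B)
⊎-finite (finite m e) (finite n f) = finite (m + n) (↔-trans (e ⊎-↔ f) (↔-sym +↔⊎))

×-finite : Finite A → Finite B → Finite (A × B)
×-finite (finite m e) (finite n f) = finite (m * n) (↔-trans (e ×-↔ f) (↔-sym *↔×))

Σ-Fin-suc↔ : ∀ {n} (B : Fin (suc n) → Set) → Σ (Fin (suc n)) B ↔ (B zero ⊎ Σ (Fin n) (B ∘ suc))
Σ-Fin-suc↔ B = mk↔ₛ′
  (λ { (zero , b) → inj₁ b ; (suc i , b) → inj₂ (i , b) })
  (λ { (inj₁ b) → zero , b ; (inj₂ (i , b)) → suc i , b })
  (λ { (inj₁ b) → refl ; (inj₂ (i , b)) → refl })
  (λ { (zero , b) → refl ; (suc i , b) → refl })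

Σ-Fin-finite : ∀ n {B : Fin n → Set} → (∀ i → Finite (B i)) → Finite (Σ (Fin n) B)
Σ-Fin-finite zero    FB = finite 0 (mk↔ₛ′ (λ ()) (λ ()) (λ ()) (λ ()))
Σ-Fin-finite (suc n) FB =
  ↔-finite (⊎-finite (FB zero) (Σ-Fin-finite n (FB ∘ suc))) (↔-sym (Σ-Fin-suc↔ _))

card-Σ-Fin : ∀ n {B : Fin n → Set} (FB : ∀ i → Finite (B i)) →
             card (Σ-Fin-finite n FB) ≡ sum (card ∘ FB)
card-Σ-Fin zero    FB = refl
card-Σ-Fin (suc n) FB = cong (card (FB zero) +_) (card-Σ-Fin n (FB ∘ suc))

Σ-finite : {B : A → Set} (FA : Finite A) → (∀ a → Finite (B a)) → Finite (Σ A B)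
Σ-finite FA FB = ↔-finite (Σ-Fin-finite (card FA) (FB ∘ decode FA)) (Σ-↔ (↔-sym (enum FA)) ↔-refl)

subset-finite : Finite A → (p : A → Bool) → Finite (Σ A (T ∘ p))
subset-finite FA p = Σ-finite FA (T-finite ∘ p)

Vec-finite : Finite A → ∀ n → Finite (Vec A n)
Vec-finite FA zero =
  finite 1 (mk↔ₛ′ (λ _ → zero) (λ _ → []) (λ { zero → refl }) (λ { [] → refl }))
Vec-finite {A} FA (suc n) = ↔-finite (×-finite FA (Vec-finite FA n))
  (mk↔ₛ′ (λ ((x , xs) : A × Vec A n) → x ∷ xs) (λ { (x ∷ xs) → x , xs })
          (λ { (x ∷ xs) → refl }) (λ _ → refl))

finite-any? : (FA : Finite A) {P : A → Set} → (∀ a → Dec (P a)) → Dec (∃ P)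
finite-any? FA {P} P? with any? (P? ∘ decode FA)
... | yes (i , p) = yes (decode FA i , p)
... | no ¬p = no λ (a , p) → ¬p (encode FA a , subst P (sym (decode-encode FA a)) p)

subset-≡ : {p : A → Bool} {a b : Σ A (T ∘ p)} → proj₁ a ≡ proj₁ b → a ≡ b
subset-≡ {a = a , s} {b = .a , t} refl = cong (a ,_) (T-irrelevant s t)

module _ (FA : Finite A) (FR : Finite R) (_≟ᴿ_ : DecidableEquality R) (f : A → R) where

  fibre-finite : (i : Fin (card FR)) → Finite (Σ A (λ a → True (f a ≟ᴿ decode FR i)))
  fibre-finite i = subset-finite FA (λ a → isYes (f a ≟ᴿ decode FR i))

  card-fibres : card FA ≡ sum (card ∘ fibre-finite)
  card-fibres = trans (↔⇒card≡ FA (Σ-Fin-finite _ fibre-finite) A↔fibres) (card-Σ-Fin _ fibre-finite)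
    where
    A↔fibres : A ↔ Σ (Fin (card FR)) (λ i → Σ A (λ a → True (f a ≟ᴿ decode FR i)))
    A↔fibres = mk↔ₛ′
      (λ a → encode FR (f a) , a , fromWitness (sym (decode-encode FR (f a))))
      (proj₁ ∘ proj₂)
      (λ { (i , a , t) → fibre-≡ (trans (cong (encode FR) (toWitness t)) (encode-decode FR i)) })
      (λ _ → refl)
      where
      fibre-≡ : ∀ {i j a s t} → i ≡ j → _≡_ {A = Σ (Fin (card FR)) λ i → Σ A λ a → True (f a ≟ᴿ decode FR i)}
                                            (i , a , s) (j , a , t)
      fibre-≡ refl = cong (λ t → _ , _ , t) (T-irrelevant _ _)

sum-cancel : ∀ {n} (s t : Fin n → ℕ) (i : Fin n) → sum s ≡ sum t →
             (∀ j → j ≢ i → s j ≡ t j) → s i ≡ t i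
sum-cancel {suc n} s t i sum≡ agree = +-cancelʳ-≡ _ (s i) (t i) (begin
  s i + sum (removeAt s i) ≡⟨ sym (sum-remove s) ⟩
  sum s                    ≡⟨ sum≡ ⟩
  sum t                    ≡⟨ sum-remove t ⟩
  t i + sum (removeAt t i) ≡⟨ cong (t i +_) (sum-cong-≗ λ j → agree (punchIn i j) (punchInᵢ≢i i j)) ⟨
  t i + sum (removeAt s i) ∎)
  where open ≡-Reasoning

sum-mono-≤ : ∀ {n} {f g : Fin n → ℕ} → (∀ i → f i ≤ g i) → sum f ≤ sum g
sum-mono-≤ {zero}  _   = z≤n
sum-mono-≤ {suc n} f≤g = +-mono-≤ (f≤g zero) (sum-mono-≤ (f≤g ∘ suc))

sum-mono-< : ∀ {n} {f g : Fin n → ℕ} → (∀ i → f i ≤ g i) → ∀ k → f k < g k → sum f < sum g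
sum-mono-< f≤g zero    fₖ<gₖ = +-mono-<-≤ fₖ<gₖ (sum-mono-≤ (f≤g ∘ suc))
sum-mono-< f≤g (suc k) fₖ<gₖ = +-mono-≤-< (f≤g zero) (sum-mono-< (f≤g ∘ suc) k fₖ<gₖ)

≤-sum : ∀ {n} (f : Fin (suc n) → ℕ) i → f i ≤ sum f
≤-sum f i = subst (f i ≤_) (sym (sum-remove f)) (m≤m+n (f i) _)

-- Isomorphisms and realisations of finite dynamics

module ≅ = _≅_

≅-from-commute : ∀ {A B} (i : A ≅ B) y → ≅.from i (step B y) ≡ step A (≅.from i y)
≅-from-commute {A} {B} i y = begin
  ≅.from i (step B y)                      ≡⟨ cong (≅.from i ∘ step B) (sym (≅.to-from i y)) ⟩
  ≅.from i (step B (≅.to i (≅.from i y)))  ≡⟨ cong (≅.from i) (sym (≅.commute i (≅.from i y))) ⟩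
  ≅.from i (≅.to i (step A (≅.from i y)))  ≡⟨ ≅.from-to i _ ⟩
  step A (≅.from i y)                      ∎
  where open ≡-Reasoning

≅-sym : ∀ {A B} → A ≅ B → B ≅ A
≅-sym i = record
  { to = ≅.from i ; from = ≅.to i ; from-to = ≅.to-from i ; to-from = ≅.from-to i
  ; commute = ≅-from-commute i }

≅-trans : ∀ {A B C} → A ≅ B → B ≅ C → A ≅ C
≅-trans i j = record
  { to = ≅.to j ∘ ≅.to i ; from = ≅.from i ∘ ≅.from j
  ; from-to = λ x → trans (cong (≅.from i) (≅.from-to j (≅.to i x))) (≅.from-to i x)
  ; to-from = λ y → trans (cong (≅.to j) (≅.to-from i (≅.from j y))) (≅.to-from j y)
  ; commute = λ x → trans (cong (≅.to j) (≅.commute i x)) (≅.commute j (≅.to i x)) }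

↔⇒≅ : ∀ {A B} (e : Fin (size A) ↔ Fin (size B)) →
      (∀ x → Inverse.to e (step A x) ≡ step B (Inverse.to e x)) → A ≅ B
↔⇒≅ e commute = record
  { to = Inverse.to e ; from = Inverse.from e
  ; from-to = Inverse.strictlyInverseʳ e ; to-from = Inverse.strictlyInverseˡ e ; commute = commute }

realise : {S : Set} → Finite S → (S → S) → FDDS
realise FS f = mkFDDS (card FS) (encode FS ∘ f ∘ decode FS)

realise-cong : ∀ {S S'} (FS : Finite S) (FS' : Finite S') {f : S → S} {g : S' → S'} (e : S ↔ S') →
               (∀ s → Inverse.to e (f s) ≡ g (Inverse.to e s)) → realise FS f ≅ realise FS' g
realise-cong FS FS' {f} {g} e commute =
  ↔⇒≅ (↔-trans (↔-sym (enum FS)) (↔-trans e (enum FS'))) λ x → begin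
    encode FS' (to (decode FS (encode FS (f (decode FS x)))))
      ≡⟨ cong (encode FS' ∘ to) (decode-encode FS _) ⟩
    encode FS' (to (f (decode FS x)))
      ≡⟨ cong (encode FS') (commute (decode FS x)) ⟩
    encode FS' (g (to (decode FS x)))
      ≡⟨ cong (encode FS' ∘ g) (decode-encode FS' _) ⟨
    encode FS' (g (decode FS' (encode FS' (to (decode FS x)))))
      ∎
  where
  open ≡-Reasoning
  to = Inverse.to e

realise-⊎ : ∀ {S S'} (FS : Finite S) (FS' : Finite S') (f : S → S) (g : S' → S') →
            realise (⊎-finite FS FS') (map⊎ f g) ≅ realise FS f ⊕ realise FS' g
realise-⊎ FS FS' f g = ↔⇒≅ ↔-refl λ y → cong (join (card FS) (card FS')) (fuse (splitAt (card FS) y))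
  where
  fuse : ∀ s → map⊎ (encode FS) (encode FS') (map⊎ f g (map⊎ (decode FS) (decode FS') s)) ≡
               map⊎ (encode FS ∘ f ∘ decode FS) (encode FS' ∘ g ∘ decode FS') s
  fuse (inj₁ _) = refl
  fuse (inj₂ _) = refl

-- Homomorphisms and their counts

IsHom : (G Z : FDDS) → (Fin (size G) → Fin (size Z)) → Set
IsHom G Z h = ∀ x → h (step G x) ≡ step Z (h x)

isHom? : ∀ G Z h → Dec (IsHom G Z h)
isHom? G Z h = all? (λ x → h (step G x) ≟ step Z (h x))

-- Storing the map as a table and the law as a decided proposition makes
-- Hom G Z a finite type with extensional equality.
record Hom (G Z : FDDS) : Set where
  constructor mkHom
  field
    table : Vec (Fin (size Z)) (size G)
    isHom : True (isHom? G Z (lookup table))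

⟦_⟧ : ∀ {G Z} → Hom G Z → Fin (size G) → Fin (size Z)
⟦ φ ⟧ = lookup (Hom.table φ)

⟦⟧-commute : ∀ {G Z} (φ : Hom G Z) → IsHom G Z ⟦ φ ⟧
⟦⟧-commute φ = toWitness (Hom.isHom φ)

toHom : ∀ {G Z} (h : Fin (size G) → Fin (size Z)) → IsHom G Z h → Hom G Z
toHom {G} {Z} h h-commute = mkHom (tabulate h) (fromWitness λ x → begin
  lookup (tabulate h) (step G x) ≡⟨ lookup∘tabulate h (step G x) ⟩
  h (step G x)                   ≡⟨ h-commute x ⟩
  step Z (h x)                   ≡⟨ cong (step Z) (sym (lookup∘tabulate h x)) ⟩
  step Z (lookup (tabulate h) x) ∎)
  where open ≡-Reasoning

lookup-ext : ∀ {A : Set} {n} {u v : Vec A n} → (∀ i → lookup u i ≡ lookup v i) → u ≡ v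
lookup-ext {u = u} {v} u≗v = trans (sym (tabulate∘lookup u)) (trans (tabulate-cong u≗v) (tabulate∘lookup v))

Hom-ext : ∀ {G Z} {φ ψ : Hom G Z} → (∀ x → ⟦ φ ⟧ x ≡ ⟦ ψ ⟧ x) → φ ≡ ψ
Hom-ext {φ = mkHom u p} {mkHom v q} u≗v with lookup-ext {u = u} {v} u≗v
... | refl = cong (mkHom u) (T-irrelevant p q)

-- Opaque, so that type checking never unfolds the enumeration behind a hom count.
opaque
  Hom-finite : ∀ G Z → Finite (Hom G Z)
  Hom-finite G Z = ↔-finite lawful-tables
    (mk↔ₛ′ (λ (v , p) → mkHom v p) (λ φ → Hom.table φ , Hom.isHom φ) (λ _ → refl) (λ _ → refl))
    where
    lawful-tables : Finite (Σ (Vec (Fin (size Z)) (size G)) λ v → True (isHom? G Z (lookup v)))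
    lawful-tables = subset-finite (Vec-finite (Fin-finite (size Z)) (size G)) λ v → isYes (isHom? G Z (lookup v))

hom : FDDS → FDDS → ℕ
hom G Z = card (Hom-finite G Z)

_∘ₕ_ : ∀ {G H Z} → Hom H Z → Hom G H → Hom G Z
_∘ₕ_ {G} {H} {Z} ψ φ =
  toHom {G} {Z} (⟦ ψ ⟧ ∘ ⟦ φ ⟧) λ x → trans (cong ⟦ ψ ⟧ (⟦⟧-commute φ x)) (⟦⟧-commute ψ _)

⟦∘ₕ⟧ : ∀ {G H Z} (ψ : Hom H Z) (φ : Hom G H) x → ⟦ ψ ∘ₕ φ ⟧ x ≡ ⟦ ψ ⟧ (⟦ φ ⟧ x)
⟦∘ₕ⟧ ψ φ = lookup∘tabulate (⟦ ψ ⟧ ∘ ⟦ φ ⟧)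

≅⇒Hom : ∀ {G H} → G ≅ H → Hom G H
≅⇒Hom {G} {H} i = toHom {G} {H} (≅.to i) (≅.commute i)

⟦≅⇒Hom⟧-inverse : ∀ {G H} (i : G ≅ H) x → ⟦ ≅⇒Hom (≅-sym i) ⟧ (⟦ ≅⇒Hom i ⟧ x) ≡ x
⟦≅⇒Hom⟧-inverse i x = begin
  ⟦ ≅⇒Hom (≅-sym i) ⟧ (⟦ ≅⇒Hom i ⟧ x) ≡⟨ lookup∘tabulate (≅.from i) _ ⟩
  ≅.from i (⟦ ≅⇒Hom i ⟧ x)             ≡⟨ cong (≅.from i) (lookup∘tabulate (≅.to i) x) ⟩
  ≅.from i (≅.to i x)                  ≡⟨ ≅.from-to i x ⟩
  x                                    ∎
  where open ≡-Reasoning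

∘ₕ-cancelʳ : ∀ {G H Z} (ψ : Hom G Z) (α : Hom H G) (β : Hom G H) →
             (∀ x → ⟦ α ⟧ (⟦ β ⟧ x) ≡ x) → (ψ ∘ₕ α) ∘ₕ β ≡ ψ
∘ₕ-cancelʳ ψ α β αβ≗id = Hom-ext λ x →
  trans (⟦∘ₕ⟧ (ψ ∘ₕ α) β x) (trans (⟦∘ₕ⟧ ψ α _) (cong ⟦ ψ ⟧ (αβ≗id x)))

∘ₕ-cancelˡ : ∀ {G H Z} (ψ : Hom G Z) (α : Hom Z H) (β : Hom H Z) →
             (∀ x → ⟦ β ⟧ (⟦ α ⟧ x) ≡ x) → β ∘ₕ (α ∘ₕ ψ) ≡ ψ
∘ₕ-cancelˡ ψ α β βα≗id = Hom-ext λ x →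
  trans (⟦∘ₕ⟧ β (α ∘ₕ ψ) x) (trans (cong ⟦ β ⟧ (⟦∘ₕ⟧ α ψ x)) (βα≗id _))

Hom-congˡ : ∀ {G G' Z} → G ≅ G' → Hom G Z ↔ Hom G' Z
Hom-congˡ i = mk↔ₛ′ (_∘ₕ ≅⇒Hom (≅-sym i)) (_∘ₕ ≅⇒Hom i)
  (λ ψ → ∘ₕ-cancelʳ ψ (≅⇒Hom i) (≅⇒Hom (≅-sym i)) (⟦≅⇒Hom⟧-inverse (≅-sym i)))
  (λ ψ → ∘ₕ-cancelʳ ψ (≅⇒Hom (≅-sym i)) (≅⇒Hom i) (⟦≅⇒Hom⟧-inverse i))

Hom-congʳ : ∀ {G Z Z'} → Z ≅ Z' → Hom G Z ↔ Hom G Z'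
Hom-congʳ i = mk↔ₛ′ (≅⇒Hom i ∘ₕ_) (≅⇒Hom (≅-sym i) ∘ₕ_)
  (λ ψ → ∘ₕ-cancelˡ ψ (≅⇒Hom (≅-sym i)) (≅⇒Hom i) (⟦≅⇒Hom⟧-inverse (≅-sym i)))
  (λ ψ → ∘ₕ-cancelˡ ψ (≅⇒Hom i) (≅⇒Hom (≅-sym i)) (⟦≅⇒Hom⟧-inverse i))

hom-congˡ : ∀ {G G'} Z → G ≅ G' → hom G Z ≡ hom G' Z
hom-congˡ Z i = ↔⇒card≡ (Hom-finite _ Z) (Hom-finite _ Z) (Hom-congˡ i)

hom-congʳ : ∀ G {Z Z'} → Z ≅ Z' → hom G Z ≡ hom G Z'
hom-congʳ G i = ↔⇒card≡ (Hom-finite G _) (Hom-finite G _) (Hom-congʳ i)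

module _ (A B : FDDS) where

  unpair : Fin (size (A ⊗ B)) → Fin (size A) × Fin (size B)
  unpair = remQuot {size A} (size B)

  π₁ : Hom (A ⊗ B) A
  π₁ = toHom {A ⊗ B} {A} (proj₁ ∘ unpair) λ _ → cong proj₁ (remQuot-combine {size A} {size B} _ _)

  π₂ : Hom (A ⊗ B) B
  π₂ = toHom {A ⊗ B} {B} (proj₂ ∘ unpair) λ _ → cong proj₂ (remQuot-combine {size A} {size B} _ _)

  ⟦π₁∘ₕ⟧ : ∀ {G} (χ : Hom G (A ⊗ B)) x → ⟦ π₁ ∘ₕ χ ⟧ x ≡ proj₁ (unpair (⟦ χ ⟧ x))
  ⟦π₁∘ₕ⟧ χ x = trans (⟦∘ₕ⟧ π₁ χ x) (lookup∘tabulate (proj₁ ∘ unpair) (⟦ χ ⟧ x))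

  ⟦π₂∘ₕ⟧ : ∀ {G} (χ : Hom G (A ⊗ B)) x → ⟦ π₂ ∘ₕ χ ⟧ x ≡ proj₂ (unpair (⟦ χ ⟧ x))
  ⟦π₂∘ₕ⟧ χ x = trans (⟦∘ₕ⟧ π₂ χ x) (lookup∘tabulate (proj₂ ∘ unpair) (⟦ χ ⟧ x))

  pairₕ : ∀ {G} → Hom G A → Hom G B → Hom G (A ⊗ B)
  pairₕ {G} φ ψ = toHom {G} {A ⊗ B} (λ x → combine (⟦ φ ⟧ x) (⟦ ψ ⟧ x)) λ x → begin
    combine (⟦ φ ⟧ (step G x)) (⟦ ψ ⟧ (step G x))
      ≡⟨ cong₂ combine (⟦⟧-commute φ x) (⟦⟧-commute ψ x) ⟩
    combine (step A (⟦ φ ⟧ x)) (step B (⟦ ψ ⟧ x))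
      ≡⟨ cong (λ (a , b) → combine (step A a) (step B b)) (remQuot-combine {size A} {size B} _ _) ⟨
    step (A ⊗ B) (combine (⟦ φ ⟧ x) (⟦ ψ ⟧ x))
      ∎
    where open ≡-Reasoning

  unpair-pairₕ : ∀ {G} (φ : Hom G A) (ψ : Hom G B) x →
                 unpair (⟦ pairₕ φ ψ ⟧ x) ≡ (⟦ φ ⟧ x , ⟦ ψ ⟧ x)
  unpair-pairₕ φ ψ x = trans (cong unpair (lookup∘tabulate (λ x → combine (⟦ φ ⟧ x) (⟦ ψ ⟧ x)) x))
                             (remQuot-combine {size A} {size B} _ _)

  Hom-⊗↔ : ∀ {G} → Hom G (A ⊗ B) ↔ (Hom G A × Hom G B)
  Hom-⊗↔ {G} = mk↔ₛ′ (λ χ → π₁ ∘ₕ χ , π₂ ∘ₕ χ) (λ (φ , ψ) → pairₕ φ ψ)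
    (λ ((φ , ψ) : Hom G A × Hom G B) → cong₂ _,_
      (Hom-ext λ x → trans (⟦π₁∘ₕ⟧ (pairₕ φ ψ) x) (cong proj₁ (unpair-pairₕ φ ψ x)))
      (Hom-ext λ x → trans (⟦π₂∘ₕ⟧ (pairₕ φ ψ) x) (cong proj₂ (unpair-pairₕ φ ψ x))))
    (λ χ → Hom-ext λ x → begin
      ⟦ pairₕ (π₁ ∘ₕ χ) (π₂ ∘ₕ χ) ⟧ x
        ≡⟨ lookup∘tabulate (λ x → combine (⟦ π₁ ∘ₕ χ ⟧ x) (⟦ π₂ ∘ₕ χ ⟧ x)) x ⟩
      combine (⟦ π₁ ∘ₕ χ ⟧ x) (⟦ π₂ ∘ₕ χ ⟧ x)
        ≡⟨ cong₂ combine (⟦π₁∘ₕ⟧ χ x) (⟦π₂∘ₕ⟧ χ x) ⟩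
      combine (proj₁ (unpair (⟦ χ ⟧ x))) (proj₂ (unpair (⟦ χ ⟧ x)))
        ≡⟨ combine-remQuot {size A} (size B) (⟦ χ ⟧ x) ⟩
      ⟦ χ ⟧ x
        ∎)
    where open ≡-Reasoning

hom-⊗ : ∀ G A B → hom G (A ⊗ B) ≡ hom G A * hom G B
hom-⊗ G A B =
  ↔⇒card≡ (Hom-finite G (A ⊗ B)) (×-finite (Hom-finite G A) (Hom-finite G B)) (Hom-⊗↔ A B)

module _ (A B : FDDS) where

  splitAt-step-⊕ : ∀ y → splitAt (size A) (step (A ⊕ B) y) ≡ map⊎ (step A) (step B) (splitAt (size A) y)
  splitAt-step-⊕ y = splitAt-join (size A) (size B) _

  step-⊕-↑ˡ : ∀ x → step (A ⊕ B) (x ↑ˡ size B) ≡ step A x ↑ˡ size B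
  step-⊕-↑ˡ x = cong (join (size A) (size B) ∘ map⊎ (step A) (step B)) (splitAt-↑ˡ (size A) x (size B))

  step-⊕-↑ʳ : ∀ x → step (A ⊕ B) (size A ↑ʳ x) ≡ size A ↑ʳ step B x
  step-⊕-↑ʳ x = cong (join (size A) (size B) ∘ map⊎ (step A) (step B)) (splitAt-↑ʳ (size A) (size B) x)

  ι₁ : Hom A (A ⊕ B)
  ι₁ = toHom {A} {A ⊕ B} (_↑ˡ size B) (sym ∘ step-⊕-↑ˡ)

  ι₂ : Hom B (A ⊕ B)
  ι₂ = toHom {B} {A ⊕ B} (size A ↑ʳ_) (sym ∘ step-⊕-↑ʳ)

  ⟦ι₁∘ₕ⟧ : ∀ {G} (α : Hom G A) x → ⟦ ι₁ ∘ₕ α ⟧ x ≡ ⟦ α ⟧ x ↑ˡ size B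
  ⟦ι₁∘ₕ⟧ α x = trans (⟦∘ₕ⟧ ι₁ α x) (lookup∘tabulate (_↑ˡ size B) (⟦ α ⟧ x))

  ⟦ι₂∘ₕ⟧ : ∀ {G} (β : Hom G B) x → ⟦ ι₂ ∘ₕ β ⟧ x ≡ size A ↑ʳ ⟦ β ⟧ x
  ⟦ι₂∘ₕ⟧ β x = trans (⟦∘ₕ⟧ ι₂ β x) (lookup∘tabulate (size A ↑ʳ_) (⟦ β ⟧ x))

  ⟦∘ₕι₁⟧ : ∀ {Z} (χ : Hom (A ⊕ B) Z) x → ⟦ χ ∘ₕ ι₁ ⟧ x ≡ ⟦ χ ⟧ (x ↑ˡ size B)
  ⟦∘ₕι₁⟧ χ x = trans (⟦∘ₕ⟧ χ ι₁ x) (cong ⟦ χ ⟧ (lookup∘tabulate (_↑ˡ size B) x))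

  ⟦∘ₕι₂⟧ : ∀ {Z} (χ : Hom (A ⊕ B) Z) x → ⟦ χ ∘ₕ ι₂ ⟧ x ≡ ⟦ χ ⟧ (size A ↑ʳ x)
  ⟦∘ₕι₂⟧ χ x = trans (⟦∘ₕ⟧ χ ι₂ x) (cong ⟦ χ ⟧ (lookup∘tabulate (size A ↑ʳ_) x))

  copairₕ : ∀ {Z} → Hom A Z → Hom B Z → Hom (A ⊕ B) Z
  copairₕ {Z} φ ψ = toHom {A ⊕ B} {Z} ([ ⟦ φ ⟧ , ⟦ ψ ⟧ ]′ ∘ splitAt (size A))
    (λ y → trans (cong [ ⟦ φ ⟧ , ⟦ ψ ⟧ ]′ (splitAt-step-⊕ y)) (copair-commute (splitAt (size A) y)))
    where
    copair-commute : ∀ s → [ ⟦ φ ⟧ , ⟦ ψ ⟧ ]′ (map⊎ (step A) (step B) s) ≡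
                           step Z ([ ⟦ φ ⟧ , ⟦ ψ ⟧ ]′ s)
    copair-commute (inj₁ a) = ⟦⟧-commute φ a
    copair-commute (inj₂ b) = ⟦⟧-commute ψ b

  ⟦copairₕ⟧ : ∀ {Z} (φ : Hom A Z) (ψ : Hom B Z) y →
              ⟦ copairₕ φ ψ ⟧ y ≡ [ ⟦ φ ⟧ , ⟦ ψ ⟧ ]′ (splitAt (size A) y)
  ⟦copairₕ⟧ φ ψ = lookup∘tabulate ([ ⟦ φ ⟧ , ⟦ ψ ⟧ ]′ ∘ splitAt (size A))

  Hom-⊕ˡ↔ : ∀ {Z} → Hom (A ⊕ B) Z ↔ (Hom A Z × Hom B Z)
  Hom-⊕ˡ↔ {Z} = mk↔ₛ′ (λ χ → χ ∘ₕ ι₁ , χ ∘ₕ ι₂) (λ (φ , ψ) → copairₕ φ ψ)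
    (λ ((φ , ψ) : Hom A Z × Hom B Z) → cong₂ _,_
      (Hom-ext λ x → trans (⟦∘ₕι₁⟧ (copairₕ φ ψ) x)
        (trans (⟦copairₕ⟧ φ ψ _) (cong [ ⟦ φ ⟧ , ⟦ ψ ⟧ ]′ (splitAt-↑ˡ (size A) x (size B)))))
      (Hom-ext λ x → trans (⟦∘ₕι₂⟧ (copairₕ φ ψ) x)
        (trans (⟦copairₕ⟧ φ ψ _) (cong [ ⟦ φ ⟧ , ⟦ ψ ⟧ ]′ (splitAt-↑ʳ (size A) (size B) x)))))
    (λ χ → Hom-ext λ y → begin
      ⟦ copairₕ (χ ∘ₕ ι₁) (χ ∘ₕ ι₂) ⟧ y
        ≡⟨ ⟦copairₕ⟧ (χ ∘ₕ ι₁) (χ ∘ₕ ι₂) y ⟩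
      [ ⟦ χ ∘ₕ ι₁ ⟧ , ⟦ χ ∘ₕ ι₂ ⟧ ]′ (splitAt (size A) y)
        ≡⟨ [,]-cong (⟦∘ₕι₁⟧ χ) (⟦∘ₕι₂⟧ χ) (splitAt (size A) y) ⟩
      [ ⟦ χ ⟧ ∘ (_↑ˡ size B) , ⟦ χ ⟧ ∘ (size A ↑ʳ_) ]′ (splitAt (size A) y)
        ≡⟨ [,]-∘ ⟦ χ ⟧ (splitAt (size A) y) ⟨
      ⟦ χ ⟧ (join (size A) (size B) (splitAt (size A) y))
        ≡⟨ cong ⟦ χ ⟧ (join-splitAt (size A) (size B) y) ⟩
      ⟦ χ ⟧ y
        ∎)
    where open ≡-Reasoning

hom-⊕ˡ : ∀ A B Z → hom (A ⊕ B) Z ≡ hom A Z * hom B Z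
hom-⊕ˡ A B Z =
  ↔⇒card≡ (Hom-finite (A ⊕ B) Z) (×-finite (Hom-finite A Z) (Hom-finite B Z)) (Hom-⊕ˡ↔ A B)

hom-𝟙 : ∀ G → hom G 𝟙 ≡ 1
hom-𝟙 G = contractible⇒card≡1 (Hom-finite G 𝟙) (toHom {G} {𝟙} (λ _ → zero) (λ _ → refl))
  (λ φ → Hom-ext λ x → Fin1-irrelevant _ _)

hom-from-empty : ∀ G Z → ¬ Fin (size G) → hom G Z ≡ 1
hom-from-empty G Z ¬x =
  contractible⇒card≡1 (Hom-finite G Z) (toHom {G} {Z} (⊥-elim ∘ ¬x) (⊥-elim ∘ ¬x)) (λ φ → Hom-ext (⊥-elim ∘ ¬x))

hom-𝟘 : ∀ G → Fin (size G) → hom G 𝟘 ≡ 0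
hom-𝟘 G x = empty⇒card≡0 (Hom-finite G 𝟘) (λ φ → ¬Fin0 (⟦ φ ⟧ x))

HasFixedPoint : FDDS → Set
HasFixedPoint A = ∃ λ a → step A a ≡ a

hasFixedPoint? : ∀ A → Dec (HasFixedPoint A)
hasFixedPoint? A = any? (λ a → step A a ≟ a)

hom-fixedPoint>0 : ∀ G {A} → HasFixedPoint A → 0 < hom G A
hom-fixedPoint>0 G {A} (a , a-fixed) =
  inhabited⇒card>0 (Hom-finite G A) (toHom {G} {A} (λ _ → a) (λ _ → sym a-fixed))

hom-𝟙-fixedPointFree : ∀ {A} → ¬ HasFixedPoint A → hom 𝟙 A ≡ 0
hom-𝟙-fixedPointFree {A} ¬fixed =
  empty⇒card≡0 (Hom-finite 𝟙 A) λ φ → ¬fixed (⟦ φ ⟧ zero , sym (⟦⟧-commute φ zero))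

-- Connected systems

Invariant : (G : FDDS) → (Fin (size G) → Bool) → Set
Invariant G c = ∀ x → c (step G x) ≡ c x

Connected : FDDS → Set
Connected G = ∀ c → Invariant G c → ∀ x y → c x ≡ c y

connected-transport : ∀ {G} → Connected G → {P : Fin (size G) → Set} → (∀ x → Dec (P x)) →
                      (∀ x → P (step G x) ⇔ P x) → ∀ {x y} → P x → P y
connected-transport {G} conn P? P-invariant {x} {y} px =
  toWitness (subst T (conn (isYes ∘ P?) invariant x y) (fromWitness px))
  where
  invariant : Invariant G (isYes ∘ P?)
  invariant z = trans (isYes≗does (P? (step G z)))
    (trans (does-⇔ (P-invariant z) (P? (step G z)) (P? z)) (sym (isYes≗does (P? z))))

IsInj₁ IsInj₂ : ∀ {L R : Set} → L ⊎ R → Set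
IsInj₁ s = ∃ λ a → s ≡ inj₁ a
IsInj₂ s = ∃ λ b → s ≡ inj₂ b

isInj₁? : ∀ {L R : Set} (s : L ⊎ R) → Dec (IsInj₁ s)
isInj₁? (inj₁ a) = yes (a , refl)
isInj₁? (inj₂ b) = no λ ()

isInj₂? : ∀ {L R : Set} (s : L ⊎ R) → Dec (IsInj₂ s)
isInj₂? (inj₁ a) = no λ ()
isInj₂? (inj₂ b) = yes (b , refl)

IsInj₁-map : ∀ {L L' R R' : Set} (f : L → L') (g : R → R') s → IsInj₁ (map⊎ f g s) ⇔ IsInj₁ s
IsInj₁-map f g (inj₁ a) = mk⇔ (λ _ → a , refl) (λ _ → f a , refl)
IsInj₁-map f g (inj₂ b) = mk⇔ (λ ()) (λ ())

IsInj₂-map : ∀ {L L' R R' : Set} (f : L → L') (g : R → R') s → IsInj₂ (map⊎ f g s) ⇔ IsInj₂ s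
IsInj₂-map f g (inj₁ a) = mk⇔ (λ ()) (λ ())
IsInj₂-map f g (inj₂ b) = mk⇔ (λ _ → b , refl) (λ _ → g b , refl)

module _ {G A B : FDDS} where

  ι₁∘ₕ-injective : {α α' : Hom G A} → ι₁ A B ∘ₕ α ≡ ι₁ A B ∘ₕ α' → α ≡ α'
  ι₁∘ₕ-injective {α} {α'} e = Hom-ext λ x → ↑ˡ-injective (size B) _ _
    (trans (sym (⟦ι₁∘ₕ⟧ A B α x)) (trans (cong (λ φ → ⟦ φ ⟧ x) e) (⟦ι₁∘ₕ⟧ A B α' x)))

  ι₂∘ₕ-injective : {β β' : Hom G B} → ι₂ A B ∘ₕ β ≡ ι₂ A B ∘ₕ β' → β ≡ β'
  ι₂∘ₕ-injective {β} {β'} e = Hom-ext λ x → ↑ʳ-injective (size A) _ _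
    (trans (sym (⟦ι₂∘ₕ⟧ A B β x)) (trans (cong (λ φ → ⟦ φ ⟧ x) e) (⟦ι₂∘ₕ⟧ A B β' x)))

  ι₁∘ₕ≢ι₂∘ₕ : Fin (size G) → (α : Hom G A) (β : Hom G B) → ι₁ A B ∘ₕ α ≢ ι₂ A B ∘ₕ β
  ι₁∘ₕ≢ι₂∘ₕ x α β e = contradiction inj₁≡inj₂ λ ()
    where
    open ≡-Reasoning
    inj₁≡inj₂ : _≡_ {A = Fin (size A) ⊎ Fin (size B)} (inj₁ (⟦ α ⟧ x)) (inj₂ (⟦ β ⟧ x))
    inj₁≡inj₂ = begin
      inj₁ (⟦ α ⟧ x)                        ≡⟨ splitAt-↑ˡ (size A) (⟦ α ⟧ x) (size B) ⟨
      splitAt (size A) (⟦ α ⟧ x ↑ˡ size B)  ≡⟨ cong (splitAt (size A)) (⟦ι₁∘ₕ⟧ A B α x) ⟨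
      splitAt (size A) (⟦ ι₁ A B ∘ₕ α ⟧ x)  ≡⟨ cong (λ φ → splitAt (size A) (⟦ φ ⟧ x)) e ⟩
      splitAt (size A) (⟦ ι₂ A B ∘ₕ β ⟧ x)  ≡⟨ cong (splitAt (size A)) (⟦ι₂∘ₕ⟧ A B β x) ⟩
      splitAt (size A) (size A ↑ʳ ⟦ β ⟧ x)  ≡⟨ splitAt-↑ʳ (size A) (size B) (⟦ β ⟧ x) ⟩
      inj₂ (⟦ β ⟧ x)                        ∎

  module _ (χ : Hom G (A ⊕ B)) where

    side : Fin (size G) → Fin (size A) ⊎ Fin (size B)
    side x = splitAt (size A) (⟦ χ ⟧ x)

    side-commute : ∀ x → side (step G x) ≡ map⊎ (step A) (step B) (side x)
    side-commute x = trans (cong (splitAt (size A)) (⟦⟧-commute χ x)) (splitAt-step-⊕ A B (⟦ χ ⟧ x))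

    factorˡ : (∀ x → IsInj₁ (side x)) → Σ (Hom G A) λ α → ι₁ A B ∘ₕ α ≡ χ
    factorˡ left = α , Hom-ext λ x → begin
      ⟦ ι₁ A B ∘ₕ α ⟧ x                               ≡⟨ ⟦ι₁∘ₕ⟧ A B α x ⟩
      ⟦ α ⟧ x ↑ˡ size B                               ≡⟨ cong (_↑ˡ size B) (lookup∘tabulate (proj₁ ∘ left) x) ⟩
      join (size A) (size B) (inj₁ (proj₁ (left x)))  ≡⟨ cong (join (size A) (size B)) (proj₂ (left x)) ⟨
      join (size A) (size B) (side x)                 ≡⟨ join-splitAt (size A) (size B) (⟦ χ ⟧ x) ⟩
      ⟦ χ ⟧ x                                         ∎
      where
      open ≡-Reasoning
      α = toHom {G} {A} (proj₁ ∘ left) λ x → inj₁-injective (begin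
        inj₁ (proj₁ (left (step G x)))   ≡⟨ proj₂ (left (step G x)) ⟨
        side (step G x)                  ≡⟨ side-commute x ⟩
        map⊎ (step A) (step B) (side x)  ≡⟨ cong (map⊎ (step A) (step B)) (proj₂ (left x)) ⟩
        inj₁ (step A (proj₁ (left x)))   ∎)

    factorʳ : (∀ x → IsInj₂ (side x)) → Σ (Hom G B) λ β → ι₂ A B ∘ₕ β ≡ χ
    factorʳ right = β , Hom-ext λ x → begin
      ⟦ ι₂ A B ∘ₕ β ⟧ x                                ≡⟨ ⟦ι₂∘ₕ⟧ A B β x ⟩
      size A ↑ʳ ⟦ β ⟧ x                                ≡⟨ cong (size A ↑ʳ_) (lookup∘tabulate (proj₁ ∘ right) x) ⟩
      join (size A) (size B) (inj₂ (proj₁ (right x)))  ≡⟨ cong (join (size A) (size B)) (proj₂ (right x)) ⟨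
      join (size A) (size B) (side x)                  ≡⟨ join-splitAt (size A) (size B) (⟦ χ ⟧ x) ⟩
      ⟦ χ ⟧ x                                          ∎
      where
      open ≡-Reasoning
      β = toHom {G} {B} (proj₁ ∘ right) λ x → inj₂-injective (begin
        inj₂ (proj₁ (right (step G x)))  ≡⟨ proj₂ (right (step G x)) ⟨
        side (step G x)                  ≡⟨ side-commute x ⟩
        map⊎ (step A) (step B) (side x)  ≡⟨ cong (map⊎ (step A) (step B)) (proj₂ (right x)) ⟩
        inj₂ (step B (proj₁ (right x)))  ∎)

    factor : Connected G → Fin (size G) →
             (Σ (Hom G A) λ α → ι₁ A B ∘ₕ α ≡ χ) ⊎ (Σ (Hom G B) λ β → ι₂ A B ∘ₕ β ≡ χ)
    factor conn x₀ with side x₀ in side-x₀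
    ... | inj₁ a = inj₁ (factorˡ λ x → connected-transport conn (isInj₁? ∘ side) invariant (a , side-x₀))
      where
      invariant : ∀ x → IsInj₁ (side (step G x)) ⇔ IsInj₁ (side x)
      invariant x = subst (λ s → IsInj₁ s ⇔ IsInj₁ (side x)) (sym (side-commute x)) (IsInj₁-map _ _ (side x))
    ... | inj₂ b = inj₂ (factorʳ λ x → connected-transport conn (isInj₂? ∘ side) invariant (b , side-x₀))
      where
      invariant : ∀ x → IsInj₂ (side (step G x)) ⇔ IsInj₂ (side x)
      invariant x = subst (λ s → IsInj₂ s ⇔ IsInj₂ (side x)) (sym (side-commute x)) (IsInj₂-map _ _ (side x))

Hom-⊕ʳ↔ : ∀ {G A B} → Connected G → Fin (size G) → Hom G (A ⊕ B) ↔ (Hom G A ⊎ Hom G B)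
Hom-⊕ʳ↔ {G} {A} {B} conn x₀ = mk↔ₛ′ (map⊎ proj₁ proj₁ ∘ factorise) inject to-from from-to
  where
  factorise = λ χ → factor {G} {A} {B} χ conn x₀
  inject = [ ι₁ A B ∘ₕ_ , ι₂ A B ∘ₕ_ ]′

  from-to : ∀ χ → inject (map⊎ proj₁ proj₁ (factorise χ)) ≡ χ
  from-to χ with factorise χ
  ... | inj₁ (_ , ι₁∘ₕα≡χ) = ι₁∘ₕα≡χ
  ... | inj₂ (_ , ι₂∘ₕβ≡χ) = ι₂∘ₕβ≡χ

  to-from : ∀ s → map⊎ proj₁ proj₁ (factorise (inject s)) ≡ s
  to-from (inj₁ α) with factorise (inject (inj₁ α))
  ... | inj₁ (α' , e) = cong inj₁ (ι₁∘ₕ-injective e)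
  ... | inj₂ (β  , e) = ⊥-elim (ι₁∘ₕ≢ι₂∘ₕ x₀ α β (sym e))
  to-from (inj₂ β) with factorise (inject (inj₂ β))
  ... | inj₁ (α  , e) = ⊥-elim (ι₁∘ₕ≢ι₂∘ₕ x₀ α β e)
  ... | inj₂ (β' , e) = cong inj₂ (ι₂∘ₕ-injective e)

hom-⊕ʳ : ∀ G A B → Connected G → Fin (size G) → hom G (A ⊕ B) ≡ hom G A + hom G B
hom-⊕ʳ G A B conn x₀ =
  ↔⇒card≡ (Hom-finite G (A ⊕ B)) (⊎-finite (Hom-finite G A) (Hom-finite G B)) (Hom-⊕ʳ↔ conn x₀)

Splits : (G : FDDS) → (Fin (size G) → Bool) → Set
Splits G c = Invariant G c × (∃ λ x → c x ≡ true) × (∃ λ y → c y ≡ false)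

Splits-resp-≗ : ∀ {G c c'} → (∀ x → c x ≡ c' x) → Splits G c → Splits G c'
Splits-resp-≗ {G} c≗c' (c-invariant , (x , cx) , (y , cy)) =
  (λ z → trans (sym (c≗c' (step G z))) (trans (c-invariant z) (c≗c' z))) ,
  (x , trans (sym (c≗c' x)) cx) , (y , trans (sym (c≗c' y)) cy)

splits? : ∀ G c → Dec (Splits G c)
splits? G c =
  all? (λ x → c (step G x) ≟ᵇ c x) ×-dec any? (λ x → c x ≟ᵇ true) ×-dec any? (λ y → c y ≟ᵇ false)

-- Invariant Boolean functions are brute-forced as tables, which range over a finite type.
connected? : ∀ G → Connected G ⊎ ∃ (Splits G)
connected? G with finite-any? (Vec-finite Bool-finite (size G)) (splits? G ∘ lookup)
... | yes (v , v-splits) = inj₂ (lookup v , v-splits)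
... | no ¬splits = inj₁ connected
  where
  connected : Connected G
  connected c c-invariant x y with c x in cx | c y in cy
  ... | true  | true  = refl
  ... | false | false = refl
  ... | true  | false = ⊥-elim (¬splits (tabulate c ,
    Splits-resp-≗ (sym ∘ lookup∘tabulate c) (c-invariant , (x , cx) , (y , cy))))
  ... | false | true  = ⊥-elim (¬splits (tabulate c ,
    Splits-resp-≗ (sym ∘ lookup∘tabulate c) (c-invariant , (y , cy) , (x , cx))))

module Partition (G : FDDS) (c : Fin (size G) → Bool) (c-invariant : Invariant G c) where

  Part : Bool → Set
  Part b = Σ (Fin (size G)) λ x → c x ≡ b

  Part-finite : ∀ b → Finite (Part b)
  Part-finite b = Σ-finite (Fin-finite (size G)) λ x → irrelevant-finite ≡ᵇ-irrelevant (c x ≟ᵇ b)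

  step-Part : ∀ {b} → Part b → Part b
  step-Part (x , cx≡b) = step G x , trans (c-invariant x) cx≡b

  part : Bool → FDDS
  part b = realise (Part-finite b) step-Part

  part< : ∀ {b} y → c y ≡ not b → size (part b) < size G
  part< {b} y cy≡¬b = injective-nonsurjective⇒card< (Part-finite b) proj₁-injective y
    λ (x , cx≡b) x≡y → not-¬ refl (trans (sym cx≡b) (trans (cong c x≡y) cy≡¬b))
    where
    proj₁-injective : ∀ {b} → Injective _≡_ _≡_ (proj₁ {B = λ x → c x ≡ b})
    proj₁-injective {x = x , e} {y = .x , e'} refl = cong (x ,_) (≡ᵇ-irrelevant e e')

  Σ-Part↔⊎ : Σ Bool Part ↔ (Part true ⊎ Part false)
  Σ-Part↔⊎ = mk↔ₛ′ (λ { (true , p) → inj₁ p ; (false , p) → inj₂ p }) [ (true ,_) , (false ,_) ]′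
                   (λ { (inj₁ _) → refl ; (inj₂ _) → refl }) (λ { (true , _) → refl ; (false , _) → refl })

  Fin↔Σ-Part : Fin (size G) ↔ Σ Bool Part
  Fin↔Σ-Part = mk↔ₛ′ (λ x → c x , x , refl) (proj₁ ∘ proj₂) (λ (b , x , cx≡b) → reindex cx≡b) (λ _ → refl)
    where
    reindex : ∀ {x b} (cx≡b : c x ≡ b) → _≡_ {A = Σ Bool Part} (c x , x , refl) (b , x , cx≡b)
    reindex refl = refl

  -- The first step uses that G is, up to η, the realisation of step G on Fin (size G).
  partition : G ≅ part true ⊕ part false
  partition = ≅-trans
    (realise-cong (Fin-finite (size G)) (⊎-finite (Part-finite true) (Part-finite false))
                  {g = map⊎ step-Part step-Part} (↔-trans Fin↔Σ-Part Σ-Part↔⊎) commute)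
    (realise-⊎ (Part-finite true) (Part-finite false) step-Part step-Part)
    where
    to : Σ Bool Part → Part true ⊎ Part false
    to = Inverse.to Σ-Part↔⊎
    commute-Σ : ∀ b x (e : c x ≡ b) → to (b , step-Part (x , e)) ≡ map⊎ step-Part step-Part (to (b , x , e))
    commute-Σ true  x e = refl
    commute-Σ false x e = refl
    commute : ∀ x → to (c (step G x) , step G x , refl) ≡ map⊎ step-Part step-Part (to (c x , x , refl))
    commute x = trans (cong to (Inverse.strictlyInverseˡ Fin↔Σ-Part (c x , step-Part (x , refl))))
                      (commute-Σ (c x) x refl)

size-induction : (P : FDDS → Set) → (∀ G → (∀ {H} → size H < size G → P H) → P G) → ∀ G → P G
size-induction P = All.wfRec (On.wellFounded size <-wellFounded) 0ℓ P

Fin? : ∀ n → Dec (Fin n)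
Fin? zero    = no ¬Fin0
Fin? (suc n) = yes zero

hom≡-from-connected : ∀ X Y → (∀ G → Connected G → Fin (size G) → hom G X ≡ hom G Y) →
                      ∀ G → hom G X ≡ hom G Y
hom≡-from-connected X Y hom≡ = size-induction _ λ G smaller → by-cases G smaller (Fin? (size G)) (connected? G)
  where
  by-cases : ∀ G → (∀ {H} → size H < size G → hom H X ≡ hom H Y) →
             Dec (Fin (size G)) → Connected G ⊎ ∃ (Splits G) → hom G X ≡ hom G Y
  by-cases G smaller (no ¬x)  _           = trans (hom-from-empty G X ¬x) (sym (hom-from-empty G Y ¬x))
  by-cases G smaller (yes x₀) (inj₁ conn) = hom≡ G conn x₀
  by-cases G smaller (yes x₀) (inj₂ (c , c-invariant , (x , cx) , (y , cy))) = begin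
    hom G X                                   ≡⟨ hom-congˡ X partition ⟩
    hom (part true ⊕ part false) X            ≡⟨ hom-⊕ˡ (part true) (part false) X ⟩
    hom (part true) X * hom (part false) X    ≡⟨ cong₂ _*_ (smaller (part< y cy)) (smaller (part< x cx)) ⟩
    hom (part true) Y * hom (part false) Y    ≡⟨ hom-⊕ˡ (part true) (part false) Y ⟨
    hom (part true ⊕ part false) Y            ≡⟨ hom-congˡ Y partition ⟨
    hom G Y                                   ∎
    where
    open ≡-Reasoning
    open Partition G c c-invariant

-- Hom counts determine a system

minimum : ∀ {n} {P : Fin n → Set} → (∀ i → Dec (P i)) → ∃ P → ∃ λ i → P i × ∀ j → P j → i ≤ᶠ j
minimum {suc n} P? (i , pᵢ) with P? zero
... | yes p₀ = zero , p₀ , λ _ _ → z≤n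
... | no ¬p₀ with i
...   | zero   = contradiction pᵢ ¬p₀
...   | suc i' with minimum (P? ∘ suc) (i' , pᵢ)
...     | j , pⱼ , j-min = suc j , pⱼ , λ { zero p → contradiction p ¬p₀ ; (suc k) p → s≤s (j-min k p) }

module Representative {n} {B : Set} (_≟_ : DecidableEquality B) (f : Fin n → B) where

  rep : Fin n → Fin n
  rep x = proj₁ (minimum (λ y → f y ≟ f x) (x , refl))

  f-rep : ∀ x → f (rep x) ≡ f x
  f-rep x = proj₁ (proj₂ (minimum (λ y → f y ≟ f x) (x , refl)))

  rep-minimal : ∀ x y → f y ≡ f x → rep x ≤ᶠ y
  rep-minimal x = proj₂ (proj₂ (minimum (λ y → f y ≟ f x) (x , refl)))

  rep-≤ : ∀ x → rep x ≤ᶠ x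
  rep-≤ x = rep-minimal x x refl

  rep-unique : ∀ x y → f y ≡ f x → (∀ z → f z ≡ f x → y ≤ᶠ z) → rep x ≡ y
  rep-unique x y fy≡fx y-min = ≤ᶠ-antisym (rep-minimal x y fy≡fx) (y-min (rep x) (f-rep x))

  rep-cong : ∀ {x y} → f x ≡ f y → rep x ≡ rep y
  rep-cong {x} {y} fx≡fy = rep-unique x (rep y) (trans (f-rep y) (sym fx≡fy))
    (λ z fz≡fx → rep-minimal y z (trans fz≡fx fx≡fy))

module _ {G Z : FDDS} (φ : Hom G Z) where
  open Representative _≟_ ⟦ φ ⟧

  -- The kernel of φ, encoded as the table sending x to the least element with the same image.
  kernel : Vec (Fin (size G)) (size G)
  kernel = tabulate rep

  lookup-kernel : ∀ x → lookup kernel x ≡ rep x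
  lookup-kernel = lookup∘tabulate rep

  kernel≡allFin⇒injective : kernel ≡ allFin (size G) → Injective _≡_ _≡_ ⟦ φ ⟧
  kernel≡allFin⇒injective kernel≡id {x} {y} φx≡φy = begin
    x      ≡⟨ rep≡id x ⟨
    rep x  ≡⟨ rep-cong φx≡φy ⟩
    rep y  ≡⟨ rep≡id y ⟩
    y      ∎
    where
    open ≡-Reasoning
    rep≡id : ∀ x → rep x ≡ x
    rep≡id x = trans (sym (lookup-kernel x)) (trans (cong (λ v → lookup v x) kernel≡id) (lookup-allFin x))

  injective⇒kernel≡allFin : Injective _≡_ _≡_ ⟦ φ ⟧ → kernel ≡ allFin (size G)
  injective⇒kernel≡allFin φ-injective = lookup-ext λ x →
    trans (lookup-kernel x) (trans (φ-injective (f-rep x)) (sym (lookup-allFin x)))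

-- Tables r with r x the least element of the class of x, for a step-compatible equivalence.
record Admissible (G : FDDS) (r : Vec (Fin (size G)) (size G)) : Set where
  field
    idempotent : ∀ x → lookup r (lookup r x) ≡ lookup r x
    decreasing : ∀ x → lookup r x ≤ᶠ x
    compatible : ∀ x y → lookup r x ≡ lookup r y → lookup r (step G x) ≡ lookup r (step G y)

admissible? : ∀ G r → Dec (Admissible G r)
admissible? G r = map′ (λ (i , d , c) → record { idempotent = i ; decreasing = d ; compatible = c })
                       (λ a → Admissible.idempotent a , Admissible.decreasing a , Admissible.compatible a)
  (all? (λ x → ρ (ρ x) ≟ ρ x) ×-dec all? (λ x → ρ x ≤? x) ×-dec
   all? λ x → all? λ y → (ρ x ≟ ρ y) →-dec (ρ (step G x) ≟ ρ (step G y)))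
  where ρ = lookup r

kernel-admissible : ∀ {G Z} (φ : Hom G Z) → Admissible G (kernel φ)
kernel-admissible {G} {Z} φ = record { idempotent = idempotent ; decreasing = decreasing ; compatible = compatible }
  where
  open Representative _≟_ ⟦ φ ⟧
  open ≡-Reasoning
  κ = lookup (kernel φ)

  idempotent : ∀ x → κ (κ x) ≡ κ x
  idempotent x = begin
    κ (κ x)      ≡⟨ lookup-kernel φ (κ x) ⟩
    rep (κ x)    ≡⟨ cong rep (lookup-kernel φ x) ⟩
    rep (rep x)  ≡⟨ rep-cong (f-rep x) ⟩
    rep x        ≡⟨ lookup-kernel φ x ⟨
    κ x          ∎

  decreasing : ∀ x → κ x ≤ᶠ x
  decreasing x = subst (_≤ᶠ x) (sym (lookup-kernel φ x)) (rep-≤ x)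

  compatible : ∀ x y → κ x ≡ κ y → κ (step G x) ≡ κ (step G y)
  compatible x y κx≡κy = begin
    κ (step G x)    ≡⟨ lookup-kernel φ (step G x) ⟩
    rep (step G x)  ≡⟨ rep-cong φ-step≡ ⟩
    rep (step G y)  ≡⟨ lookup-kernel φ (step G y) ⟨
    κ (step G y)    ∎
    where
    rep-x≡rep-y = trans (sym (lookup-kernel φ x)) (trans κx≡κy (lookup-kernel φ y))
    φ-step≡ : ⟦ φ ⟧ (step G x) ≡ ⟦ φ ⟧ (step G y)
    φ-step≡ = begin
      ⟦ φ ⟧ (step G x)        ≡⟨ ⟦⟧-commute φ x ⟩
      step Z (⟦ φ ⟧ x)        ≡⟨ cong (step Z) (f-rep x) ⟨
      step Z (⟦ φ ⟧ (rep x))  ≡⟨ cong (step Z ∘ ⟦ φ ⟧) rep-x≡rep-y ⟩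
      step Z (⟦ φ ⟧ (rep y))  ≡⟨ cong (step Z) (f-rep y) ⟩
      step Z (⟦ φ ⟧ y)        ≡⟨ ⟦⟧-commute φ y ⟨
      ⟦ φ ⟧ (step G y)        ∎

HasKernel : ∀ {G Z} → Vec (Fin (size G)) (size G) → Hom G Z → Bool
HasKernel r φ = isYes (≡-decᵛ _≟_ (kernel φ) r)

homWithKernel : (G : FDDS) → Vec (Fin (size G)) (size G) → FDDS → ℕ
homWithKernel G r Z = card (subset-finite (Hom-finite G Z) (HasKernel r))

inj : FDDS → FDDS → ℕ
inj G Z = homWithKernel G (allFin (size G)) Z

Table-finite : ∀ n → Finite (Vec (Fin n) n)
Table-finite n = Vec-finite (Fin-finite n) n

hom≡∑homWithKernel : ∀ G Z → hom G Z ≡ sum λ i → homWithKernel G (decode (Table-finite (size G)) i) Z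
hom≡∑homWithKernel G Z = card-fibres (Hom-finite G Z) (Table-finite (size G)) (≡-decᵛ _≟_) kernel

homWithKernel-inadmissible : ∀ G Z {r} → ¬ Admissible G r → homWithKernel G r Z ≡ 0
homWithKernel-inadmissible G Z {r} ¬admissible = empty⇒card≡0 (subset-finite (Hom-finite G Z) (HasKernel r))
  λ (φ , has-r) → ¬admissible (subst (Admissible G) (toWitness has-r) (kernel-admissible φ))

-- The states of the quotient are the fixed points of r, i.e. the least elements of the classes.
module Quotient (G : FDDS) (r : Vec (Fin (size G)) (size G)) (admissible : Admissible G r) where
  open Admissible admissible

  ρ : Fin (size G) → Fin (size G)
  ρ = lookup r

  Class : Set
  Class = Σ (Fin (size G)) λ x → True (ρ x ≟ x)

  Class-finite : Finite Class
  Class-finite = subset-finite (Fin-finite (size G)) λ x → isYes (ρ x ≟ x)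

  [_] : Fin (size G) → Class
  [ x ] = ρ x , fromWitness (idempotent x)

  [proj₁] : ∀ c → [ proj₁ c ] ≡ c
  [proj₁] (x , ρx≡x) = subset-≡ (toWitness ρx≡x)

  step-Class : Class → Class
  step-Class (x , _) = [ step G x ]

  quotient : FDDS
  quotient = realise Class-finite step-Class

  quotient< : ∀ x → ρ x ≢ x → size quotient < size G
  quotient< x ρx≢x = injective-nonsurjective⇒card< Class-finite subset-≡ x
    λ (y , ρy≡y) y≡x → ρx≢x (subst (λ z → ρ z ≡ z) y≡x (toWitness ρy≡y))

  private
    enc = encode Class-finite
    dec = decode Class-finite

  π : Hom G quotient
  π = toHom {G} {quotient} (enc ∘ [_]) λ x → cong enc (begin
    [ step G x ]                  ≡⟨ subset-≡ (compatible x (ρ x) (sym (idempotent x))) ⟩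
    step-Class [ x ]              ≡⟨ cong step-Class (decode-encode Class-finite [ x ]) ⟨
    step-Class (dec (enc [ x ]))  ∎)
    where open ≡-Reasoning

  ⟦π⟧ : ∀ x → ⟦ π ⟧ x ≡ enc [ x ]
  ⟦π⟧ = lookup∘tabulate (enc ∘ [_])

  module _ {Z : FDDS} (φ : Hom G Z) (kernel≡r : kernel φ ≡ r) where
    open Representative _≟_ ⟦ φ ⟧

    ρ≡rep : ∀ x → ρ x ≡ rep x
    ρ≡rep x = trans (cong (λ v → lookup v x) (sym kernel≡r)) (lookup-kernel φ x)

    φ∘ρ : ∀ x → ⟦ φ ⟧ (ρ x) ≡ ⟦ φ ⟧ x
    φ∘ρ x = trans (cong ⟦ φ ⟧ (ρ≡rep x)) (f-rep x)

    descend : Hom quotient Z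
    descend = toHom {quotient} {Z} (⟦ φ ⟧ ∘ proj₁ ∘ dec) λ i → begin
      ⟦ φ ⟧ (proj₁ (dec (enc (step-Class (dec i)))))  ≡⟨ cong (⟦ φ ⟧ ∘ proj₁) (decode-encode Class-finite _) ⟩
      ⟦ φ ⟧ (ρ (step G (proj₁ (dec i))))              ≡⟨ φ∘ρ _ ⟩
      ⟦ φ ⟧ (step G (proj₁ (dec i)))                  ≡⟨ ⟦⟧-commute φ _ ⟩
      step Z (⟦ φ ⟧ (proj₁ (dec i)))                  ∎
      where open ≡-Reasoning

    ⟦descend⟧ : ∀ i → ⟦ descend ⟧ i ≡ ⟦ φ ⟧ (proj₁ (dec i))
    ⟦descend⟧ = lookup∘tabulate (⟦ φ ⟧ ∘ proj₁ ∘ dec)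

    descend-injective : Injective _≡_ _≡_ ⟦ descend ⟧
    descend-injective {i} {j} eq = decode-injective Class-finite (subset-≡ (begin
      proj₁ (dec i)      ≡⟨ toWitness (proj₂ (dec i)) ⟨
      ρ (proj₁ (dec i))  ≡⟨ trans (ρ≡rep _) (trans (rep-cong φi≡φj) (sym (ρ≡rep _))) ⟩
      ρ (proj₁ (dec j))  ≡⟨ toWitness (proj₂ (dec j)) ⟩
      proj₁ (dec j)      ∎))
      where
      open ≡-Reasoning
      φi≡φj = trans (sym (⟦descend⟧ i)) (trans eq (⟦descend⟧ j))

    descend∘π : descend ∘ₕ π ≡ φ
    descend∘π = Hom-ext λ x → begin
      ⟦ descend ∘ₕ π ⟧ x               ≡⟨ ⟦∘ₕ⟧ descend π x ⟩
      ⟦ descend ⟧ (⟦ π ⟧ x)            ≡⟨ cong ⟦ descend ⟧ (⟦π⟧ x) ⟩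
      ⟦ descend ⟧ (enc [ x ])          ≡⟨ ⟦descend⟧ _ ⟩
      ⟦ φ ⟧ (proj₁ (dec (enc [ x ])))  ≡⟨ cong (⟦ φ ⟧ ∘ proj₁) (decode-encode Class-finite _) ⟩
      ⟦ φ ⟧ (ρ x)                      ≡⟨ φ∘ρ x ⟩
      ⟦ φ ⟧ x                          ∎
      where open ≡-Reasoning

  module _ {Z : FDDS} (ψ : Hom quotient Z) (ψ-injective : Injective _≡_ _≡_ ⟦ ψ ⟧) where

    ⟦∘π⟧ : ∀ x → ⟦ ψ ∘ₕ π ⟧ x ≡ ⟦ ψ ⟧ (enc [ x ])
    ⟦∘π⟧ x = trans (⟦∘ₕ⟧ ψ π x) (cong ⟦ ψ ⟧ (⟦π⟧ x))

    kernel-∘π : kernel (ψ ∘ₕ π) ≡ r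
    kernel-∘π = lookup-ext λ x →
      trans (lookup-kernel (ψ ∘ₕ π) x) (rep-unique x (ρ x) (same-class (idempotent x)) (ρ-minimal x))
      where
      open Representative _≟_ ⟦ ψ ∘ₕ π ⟧
      same-class : ∀ {x y} → ρ x ≡ ρ y → ⟦ ψ ∘ₕ π ⟧ x ≡ ⟦ ψ ∘ₕ π ⟧ y
      same-class {x} {y} ρx≡ρy = trans (⟦∘π⟧ x) (trans (cong (⟦ ψ ⟧ ∘ enc) (subset-≡ ρx≡ρy)) (sym (⟦∘π⟧ y)))
      class-injective : ∀ {x y} → ⟦ ψ ∘ₕ π ⟧ x ≡ ⟦ ψ ∘ₕ π ⟧ y → ρ x ≡ ρ y
      class-injective {x} {y} eq =
        cong proj₁ (encode-injective Class-finite (ψ-injective (trans (sym (⟦∘π⟧ x)) (trans eq (⟦∘π⟧ y)))))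
      ρ-minimal : ∀ x z → ⟦ ψ ∘ₕ π ⟧ z ≡ ⟦ ψ ∘ₕ π ⟧ x → ρ x ≤ᶠ z
      ρ-minimal x z eq = subst (_≤ᶠ z) (class-injective eq) (decreasing z)

    descend-∘π : (kernel≡r : kernel (ψ ∘ₕ π) ≡ r) → descend (ψ ∘ₕ π) kernel≡r ≡ ψ
    descend-∘π kernel≡r = Hom-ext λ i → begin
      ⟦ descend (ψ ∘ₕ π) kernel≡r ⟧ i  ≡⟨ ⟦descend⟧ (ψ ∘ₕ π) kernel≡r i ⟩
      ⟦ ψ ∘ₕ π ⟧ (proj₁ (dec i))       ≡⟨ ⟦∘π⟧ _ ⟩
      ⟦ ψ ⟧ (enc [ proj₁ (dec i) ])    ≡⟨ cong (⟦ ψ ⟧ ∘ enc) ([proj₁] (dec i)) ⟩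
      ⟦ ψ ⟧ (enc (dec i))              ≡⟨ cong ⟦ ψ ⟧ (encode-decode Class-finite i) ⟩
      ⟦ ψ ⟧ i                          ∎
      where open ≡-Reasoning

  homWithKernel≡inj : ∀ Z → homWithKernel G r Z ≡ inj quotient Z
  homWithKernel≡inj Z = ↔⇒card≡ (subset-finite (Hom-finite G Z) (HasKernel r))
    (subset-finite (Hom-finite quotient Z) (HasKernel (allFin _)))
    (mk↔ₛ′ to from to-from (λ (φ , has-r) → subset-≡ (descend∘π φ (toWitness has-r))))
    where
    to : Σ (Hom G Z) (T ∘ HasKernel r) → Σ (Hom quotient Z) (T ∘ HasKernel (allFin _))
    to (φ , has-r) = descend φ kernel≡r ,
                     fromWitness (injective⇒kernel≡allFin (descend φ kernel≡r) (descend-injective φ kernel≡r))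
      where kernel≡r = toWitness has-r
    from : Σ (Hom quotient Z) (T ∘ HasKernel (allFin _)) → Σ (Hom G Z) (T ∘ HasKernel r)
    from (ψ , has-id) = ψ ∘ₕ π , fromWitness (kernel-∘π ψ (kernel≡allFin⇒injective ψ (toWitness has-id)))
    to-from : ∀ y → to (from y) ≡ y
    to-from (ψ , has-id) = subset-≡ (descend-∘π ψ (kernel≡allFin⇒injective ψ (toWitness has-id))
                                                 (toWitness (proj₂ (from (ψ , has-id)))))

homWithKernel-≡ : ∀ {X Y} G → (∀ {H} → size H < size G → inj H X ≡ inj H Y) →
                  ∀ r → r ≢ allFin (size G) → homWithKernel G r X ≡ homWithKernel G r Y
homWithKernel-≡ {X} {Y} G inj≡ r r≢id with admissible? G r
... | no ¬admissible =
  trans (homWithKernel-inadmissible G X ¬admissible) (sym (homWithKernel-inadmissible G Y ¬admissible))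
... | yes admissible = begin
  homWithKernel G r X  ≡⟨ homWithKernel≡inj X ⟩
  inj quotient X       ≡⟨ inj≡ (quotient< x ρx≢x) ⟩
  inj quotient Y       ≡⟨ homWithKernel≡inj Y ⟨
  homWithKernel G r Y  ∎
  where
  open ≡-Reasoning
  open Quotient G r admissible
  moved : ∃ λ x → ρ x ≢ x
  moved = ¬∀⟶∃¬ (size G) _ (λ x → ρ x ≟ x) λ ρ≗id →
    r≢id (lookup-ext λ x → trans (ρ≗id x) (sym (lookup-allFin x)))
  x = proj₁ moved
  ρx≢x = proj₂ moved

-- In hom G Z = ∑ᵣ homWithKernel G r Z every term but r = id is an inj count of a smaller system.
inj≡-from-smaller : ∀ {X Y} → (∀ G → hom G X ≡ hom G Y) →
                    ∀ G → (∀ {H} → size H < size G → inj H X ≡ inj H Y) → inj G X ≡ inj G Y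
inj≡-from-smaller {X} {Y} hom≡ G inj≡ = begin
  inj G X                           ≡⟨ cong (λ r → homWithKernel G r X) (decode-encode TG (allFin _)) ⟨
  homWithKernel G (decode TG i₀) X  ≡⟨ sum-cancel _ _ i₀ ∑≡ others ⟩
  homWithKernel G (decode TG i₀) Y  ≡⟨ cong (λ r → homWithKernel G r Y) (decode-encode TG (allFin _)) ⟩
  inj G Y                           ∎
  where
  open ≡-Reasoning
  TG = Table-finite (size G)
  i₀ = encode TG (allFin (size G))
  ∑≡ : sum (λ i → homWithKernel G (decode TG i) X) ≡ sum (λ i → homWithKernel G (decode TG i) Y)
  ∑≡ = trans (sym (hom≡∑homWithKernel G X)) (trans (hom≡ G) (hom≡∑homWithKernel G Y))
  others : ∀ i → i ≢ i₀ → homWithKernel G (decode TG i) X ≡ homWithKernel G (decode TG i) Y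
  others i i≢i₀ = homWithKernel-≡ G inj≡ (decode TG i) λ r≡id →
    i≢i₀ (trans (sym (encode-decode TG i)) (cong (encode TG) r≡id))

hom≡⇒inj≡ : ∀ {X Y} → (∀ G → hom G X ≡ hom G Y) → ∀ G → inj G X ≡ inj G Y
hom≡⇒inj≡ hom≡ = size-induction _ (inj≡-from-smaller hom≡)

idₕ : ∀ {G} → Hom G G
idₕ {G} = toHom {G} {G} id (λ _ → refl)

inj-self>0 : ∀ G → 0 < inj G G
inj-self>0 G = inhabited⇒card>0 (subset-finite (Hom-finite G G) (HasKernel (allFin _)))
  (idₕ , fromWitness (injective⇒kernel≡allFin (idₕ {G}) λ {x} {y} e →
    trans (sym (lookup∘tabulate id x)) (trans e (lookup∘tabulate id y))))

injective-hom : ∀ {G Z} → 0 < inj G Z → Σ (Hom G Z) λ φ → Injective _≡_ _≡_ ⟦ φ ⟧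
injective-hom {G} {Z} inj>0 with card>0⇒inhabited (subset-finite (Hom-finite G Z) (HasKernel (allFin _))) inj>0
... | φ , has-id = φ , kernel≡allFin⇒injective φ (toWitness has-id)

injective-hom⇒≅ : ∀ {X Y} (φ : Hom X Y) → Injective _≡_ _≡_ ⟦ φ ⟧ → size Y ≤ size X → X ≅ Y
injective-hom⇒≅ {X} {Y} φ φ-injective Y≤X = record
  { to = ⟦ φ ⟧ ; from = proj₁ ∘ preimage
  ; from-to = λ x → φ-injective (proj₂ (preimage (⟦ φ ⟧ x))) ; to-from = proj₂ ∘ preimage
  ; commute = ⟦⟧-commute φ }
  where
  preimage : ∀ y → ∃ λ x → ⟦ φ ⟧ x ≡ y
  preimage y with any? (λ x → ⟦ φ ⟧ x ≟ y)
  ... | yes found = found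
  ... | no ¬found = contradiction Y≤X
    (<⇒≱ (injective-nonsurjective⇒card< (Fin-finite (size X)) φ-injective y λ x e → ¬found (x , e)))

hom≡⇒≅ : ∀ {X Y} → (∀ G → hom G X ≡ hom G Y) → X ≅ Y
hom≡⇒≅ {X} {Y} hom≡ = injective-hom⇒≅ φ φ-injective (injective⇒≤ ψ-injective)
  where
  inj≡ = hom≡⇒inj≡ hom≡
  φ-inj = injective-hom (subst (0 <_) (inj≡ X) (inj-self>0 X))
  ψ-inj = injective-hom (subst (0 <_) (sym (inj≡ Y)) (inj-self>0 Y))
  φ = proj₁ φ-inj
  φ-injective = proj₂ φ-inj
  ψ-injective = proj₂ ψ-inj

hom≡-connected⇒≅ : ∀ {X Y} → (∀ G → Connected G → Fin (size G) → hom G X ≡ hom G Y) → X ≅ Y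
hom≡-connected⇒≅ {X} {Y} = hom≡⇒≅ ∘ hom≡-from-connected X Y

-- Coefficients with a fixed point

fixedPoint⇒cancelable : ∀ {A} → HasFixedPoint A → Cancelable A
fixedPoint⇒cancelable {A} fixed B C AB≅AC = hom≡⇒≅ λ G →
  *-cancelˡ-≡ (hom G B) (hom G C) (hom G A) {{>-nonZero (hom-fixedPoint>0 G fixed)}} (begin
    hom G A * hom G B  ≡⟨ hom-⊗ G A B ⟨
    hom G (A ⊗ B)      ≡⟨ hom-congʳ G AB≅AC ⟩
    hom G (A ⊗ C)      ≡⟨ hom-⊗ G A C ⟩
    hom G A * hom G C  ∎)
  where open ≡-Reasoning

hom-^ : ∀ G X k → hom G (X ^ k) ≡ hom G X ℕ.^ k
hom-^ G X zero    = hom-𝟙 G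
hom-^ G X (suc k) =
  trans (hom-⊗ G (X ^ k) X) (trans (cong (_* hom G X) (hom-^ G X k)) (*-comm (hom G X ℕ.^ k) (hom G X)))

hom-∑ : ∀ G → Connected G → Fin (size G) → ∀ n F → hom G (∑ n F) ≡ sum (λ i → hom G (F i))
hom-∑ G conn x₀ zero    F = hom-𝟘 G x₀
hom-∑ G conn x₀ (suc n) F =
  trans (hom-⊕ʳ G (F zero) (∑ n (F ∘ suc)) conn x₀) (cong (hom G (F zero) +_) (hom-∑ G conn x₀ n (F ∘ suc)))

evalℕ : ∀ m → (Fin (suc m) → ℕ) → ℕ → ℕ
evalℕ m a x = sum λ i → a i * x ℕ.^ toℕ i

hom-evalPoly : ∀ G → Connected G → Fin (size G) →
               ∀ m A X → hom G (evalPoly m A X) ≡ evalℕ m (λ i → hom G (A i)) (hom G X)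
hom-evalPoly G conn x₀ m A X = trans (hom-∑ G conn x₀ (suc m) (λ i → A i ⊗ (X ^ toℕ i))) (sum-cong-≗ λ i →
  trans (hom-⊗ G (A i) (X ^ toℕ i)) (cong (hom G (A i) *_) (hom-^ G X (toℕ i))))

evalℕ-strictlyIncreasing : ∀ m a k → 0 < toℕ k → 0 < a k →
                           ∀ {x y} → x < y → evalℕ m a x < evalℕ m a y
evalℕ-strictlyIncreasing m a k k>0 aₖ>0 x<y =
  sum-mono-< (λ i → *-monoʳ-≤ (a i) (^-monoˡ-≤ (toℕ i) (<⇒≤ x<y))) k
    (*-monoʳ-< (a k) {{>-nonZero aₖ>0}} (^-monoˡ-< (toℕ k) {{>-nonZero k>0}} x<y))

evalℕ-injective : ∀ m a k → 0 < toℕ k → 0 < a k → ∀ x y → evalℕ m a x ≡ evalℕ m a y → x ≡ y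
evalℕ-injective m a k k>0 aₖ>0 x y eval≡ with <-cmp x y
... | tri< x<y _ _ = contradiction eval≡ (<⇒≢ (evalℕ-strictlyIncreasing m a k k>0 aₖ>0 x<y))
... | tri≈ _ x≡y _ = x≡y
... | tri> _ _ y<x = contradiction (sym eval≡) (<⇒≢ (evalℕ-strictlyIncreasing m a k k>0 aₖ>0 y<x))

fixedPoint⇒evalPoly-injective : ∀ m A k → 0 < toℕ k → HasFixedPoint (A k) → PolyInjective m A
fixedPoint⇒evalPoly-injective m A k k>0 fixed X Y P[X]≅P[Y] = hom≡-connected⇒≅ λ G conn x₀ →
  evalℕ-injective m (λ i → hom G (A i)) k k>0 (hom-fixedPoint>0 G fixed) _ _ (begin
    evalℕ m (λ i → hom G (A i)) (hom G X)  ≡⟨ hom-evalPoly G conn x₀ m A X ⟨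
    hom G (evalPoly m A X)                 ≡⟨ hom-congʳ G P[X]≅P[Y] ⟩
    hom G (evalPoly m A Y)                 ≡⟨ hom-evalPoly G conn x₀ m A Y ⟩
    evalℕ m (λ i → hom G (A i)) (hom G Y)  ∎)
  where open ≡-Reasoning

-- Cycles

iterate : ∀ {S : Set} → (S → S) → ℕ → S → S
iterate f zero    x = x
iterate f (suc n) x = f (iterate f n x)

iterate-commute : ∀ {S : Set} (f : S → S) n x → iterate f n (f x) ≡ f (iterate f n x)
iterate-commute f zero    x = refl
iterate-commute f (suc n) x = cong f (iterate-commute f n x)

iterate-+ : ∀ {S : Set} (f : S → S) m n x → iterate f (m + n) x ≡ iterate f m (iterate f n x)
iterate-+ f zero    n x = refl
iterate-+ f (suc m) n x = cong f (iterate-+ f m n x)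

iterate-comm : ∀ {S : Set} (f : S → S) m n x → iterate f m (iterate f n x) ≡ iterate f n (iterate f m x)
iterate-comm f m n x =
  trans (sym (iterate-+ f m n x)) (trans (cong (λ a → iterate f a x) (+-comm m n)) (iterate-+ f n m x))

iterate-split : ∀ {S : Set} (f : S → S) {m n} x → n ≤ m → iterate f m x ≡ iterate f (m ∸ n) (iterate f n x)
iterate-split f {m} {n} x n≤m = trans (cong (λ a → iterate f a x) (sym (m∸n+n≡m n≤m))) (iterate-+ f (m ∸ n) n x)

iterate-mod : ∀ {S : Set} (f : S → S) d .{{_ : NonZero d}} {z} → iterate f d z ≡ z →
              ∀ a → iterate f a z ≡ iterate f (a % d) z
iterate-mod f d {z} periodic a = begin
  iterate f a z                                  ≡⟨ cong (λ n → iterate f n z) (m≡m%n+[m/n]*n a d) ⟩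
  iterate f (a % d + (a / d) * d) z              ≡⟨ iterate-+ f (a % d) ((a / d) * d) z ⟩
  iterate f (a % d) (iterate f ((a / d) * d) z)  ≡⟨ cong (iterate f (a % d)) (iterate-multiple (a / d)) ⟩
  iterate f (a % d) z                            ∎
  where
  open ≡-Reasoning
  iterate-multiple : ∀ q → iterate f (q * d) z ≡ z
  iterate-multiple zero    = refl
  iterate-multiple (suc q) =
    trans (iterate-+ f d (q * d) z) (trans (cong (iterate f d) (iterate-multiple q)) periodic)

rotate : ∀ {k} → Fin (suc k) → Fin (suc k)
rotate {k} i = suc (toℕ i) mod suc k

-- Cycle k is the cycle of length k + 1.
Cycle : ℕ → FDDS
Cycle k = mkFDDS (suc k) rotate

Discrete : ℕ → FDDS
Discrete n = mkFDDS n id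

module _ {k : ℕ} where

  toℕ-rotate : ∀ (i : Fin (suc k)) → toℕ (rotate i) ≡ suc (toℕ i) % suc k
  toℕ-rotate i = toℕ-fromℕ< (m%n<n (suc (toℕ i)) (suc k))

  toℕ-iterate-rotate : ∀ j (i : Fin (suc k)) → toℕ (iterate rotate j i) ≡ (toℕ i + j) % suc k
  toℕ-iterate-rotate zero    i = sym (trans (cong (_% suc k) (+-identityʳ (toℕ i))) (m<n⇒m%n≡m (toℕ<n i)))
  toℕ-iterate-rotate (suc j) i = begin
    toℕ (rotate (iterate rotate j i))        ≡⟨ toℕ-rotate _ ⟩
    suc (toℕ (iterate rotate j i)) % suc k   ≡⟨ cong (λ n → suc n % suc k) (toℕ-iterate-rotate j i) ⟩
    suc ((toℕ i + j) % suc k) % suc k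
      ≡⟨ %-distribˡ-+ 1 ((toℕ i + j) % suc k) (suc k) ⟩
    (1 % suc k + (toℕ i + j) % suc k % suc k) % suc k
      ≡⟨ cong (λ n → (1 % suc k + n) % suc k) (m%n%n≡m%n (toℕ i + j) (suc k)) ⟩
    (1 % suc k + (toℕ i + j) % suc k) % suc k
      ≡⟨ %-distribˡ-+ 1 (toℕ i + j) (suc k) ⟨
    suc (toℕ i + j) % suc k                  ≡⟨ cong (_% suc k) (+-suc (toℕ i) j) ⟨
    (toℕ i + suc j) % suc k                  ∎
    where open ≡-Reasoning

  iterate-rotate-period : ∀ (i : Fin (suc k)) → iterate rotate (suc k) i ≡ i
  iterate-rotate-period i = toℕ-injective (trans (toℕ-iterate-rotate (suc k) i)
    (trans ([m+n]%n≡m%n (toℕ i) (suc k)) (m<n⇒m%n≡m (toℕ<n i))))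

  rotate-injective : Injective _≡_ _≡_ (rotate {k})
  rotate-injective {i} {j} rotate-i≡rotate-j = begin
    i                             ≡⟨ iterate-rotate-period i ⟨
    iterate rotate (suc k) i      ≡⟨ iterate-commute rotate k i ⟨
    iterate rotate k (rotate i)   ≡⟨ cong (iterate rotate k) rotate-i≡rotate-j ⟩
    iterate rotate k (rotate j)   ≡⟨ iterate-commute rotate k j ⟩
    iterate rotate (suc k) j      ≡⟨ iterate-rotate-period j ⟩
    j                             ∎
    where open ≡-Reasoning

  distance : Fin (suc k) → Fin (suc k) → ℕ
  distance i j = (suc k ∸ toℕ i) + toℕ j

  iterate-rotate-distance : ∀ i j → iterate rotate (distance i j) i ≡ j
  iterate-rotate-distance i j = toℕ-injective (begin
    toℕ (iterate rotate (distance i j) i)    ≡⟨ toℕ-iterate-rotate (distance i j) i ⟩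
    (toℕ i + ((suc k ∸ toℕ i) + toℕ j)) % suc k ≡⟨ cong (_% suc k) (+-assoc (toℕ i) _ (toℕ j)) ⟨
    (toℕ i + (suc k ∸ toℕ i) + toℕ j) % suc k
      ≡⟨ cong (λ n → (n + toℕ j) % suc k) (m+[n∸m]≡n (<⇒≤ (toℕ<n i))) ⟩
    (suc k + toℕ j) % suc k                  ≡⟨ cong (_% suc k) (+-comm (suc k) (toℕ j)) ⟩
    (toℕ j + suc k) % suc k                  ≡⟨ [m+n]%n≡m%n (toℕ j) (suc k) ⟩
    toℕ j % suc k                            ≡⟨ m<n⇒m%n≡m (toℕ<n j) ⟩
    toℕ j                                    ∎)
    where open ≡-Reasoning

  rotate-fixedPointFree : 0 < k → ¬ HasFixedPoint (Cycle k)
  rotate-fixedPointFree k>0 (i , rotate-i≡i) with m≤n⇒m<n∨m≡n (≤-pred (toℕ<n i))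
  ... | inj₁ i<k = 1+n≢n (begin
    suc (toℕ i)            ≡⟨ m<n⇒m%n≡m (s≤s i<k) ⟨
    suc (toℕ i) % suc k    ≡⟨ toℕ-rotate i ⟨
    toℕ (rotate i)         ≡⟨ cong toℕ rotate-i≡i ⟩
    toℕ i                  ∎)
    where open ≡-Reasoning
  ... | inj₂ i≡k = <⇒≢ k>0 (begin
    0                      ≡⟨ n%n≡0 (suc k) ⟨
    suc k % suc k          ≡⟨ cong (λ n → suc n % suc k) i≡k ⟨
    suc (toℕ i) % suc k    ≡⟨ toℕ-rotate i ⟨
    toℕ (rotate i)         ≡⟨ cong toℕ rotate-i≡i ⟩
    toℕ i                  ≡⟨ i≡k ⟩
    k                      ∎)
    where open ≡-Reasoning

  rotationₕ : ℕ → Hom (Cycle k) (Cycle k)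
  rotationₕ j = toHom {Cycle k} {Cycle k} (iterate rotate j) (iterate-commute rotate j)

module _ {G : FDDS} (conn : Connected G) (x₀ : Fin (size G)) where

  Hom-Cycle-ext : ∀ {k} {φ ψ : Hom G (Cycle k)} → ⟦ φ ⟧ x₀ ≡ ⟦ ψ ⟧ x₀ → φ ≡ ψ
  Hom-Cycle-ext {k} {φ} {ψ} agree-at-x₀ =
    Hom-ext λ x → connected-transport conn (λ y → ⟦ φ ⟧ y ≟ ⟦ ψ ⟧ y) invariant agree-at-x₀
    where
    invariant : ∀ y → (⟦ φ ⟧ (step G y) ≡ ⟦ ψ ⟧ (step G y)) ⇔ (⟦ φ ⟧ y ≡ ⟦ ψ ⟧ y)
    invariant y = mk⇔
      (λ e → rotate-injective (trans (sym (⟦⟧-commute φ y)) (trans e (⟦⟧-commute ψ y))))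
      (λ e → trans (⟦⟧-commute φ y) (trans (cong rotate e) (sym (⟦⟧-commute ψ y))))

  -- Rotations act simply transitively on the homs into a cycle.
  hom-Cycle : ∀ {k} → Hom G (Cycle k) → hom G (Cycle k) ≡ suc k
  hom-Cycle {k} φ₀ = ↔⇒card≡ (Hom-finite G (Cycle k)) (Fin-finite (suc k))
    (mk↔ₛ′ (λ φ → ⟦ φ ⟧ x₀) rotated rotated-at-x₀ λ φ → Hom-Cycle-ext (rotated-at-x₀ (⟦ φ ⟧ x₀)))
    where
    rotated : Fin (suc k) → Hom G (Cycle k)
    rotated j = rotationₕ (distance (⟦ φ₀ ⟧ x₀) j) ∘ₕ φ₀
    rotated-at-x₀ : ∀ j → ⟦ rotated j ⟧ x₀ ≡ j
    rotated-at-x₀ j = trans (⟦∘ₕ⟧ (rotationₕ d) φ₀ x₀)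
      (trans (lookup∘tabulate (iterate rotate d) (⟦ φ₀ ⟧ x₀)) (iterate-rotate-distance (⟦ φ₀ ⟧ x₀) j))
      where d = distance (⟦ φ₀ ⟧ x₀) j

  hom-Discrete : ∀ n → hom G (Discrete n) ≡ n
  hom-Discrete n = ↔⇒card≡ (Hom-finite G (Discrete n)) (Fin-finite n)
    (mk↔ₛ′ (λ φ → ⟦ φ ⟧ x₀) constant (λ j → lookup∘tabulate (λ _ → j) x₀)
           λ φ → Hom-ext λ x → trans (lookup∘tabulate (λ _ → ⟦ φ ⟧ x₀) x) (constant-on-G φ x))
    where
    constant : Fin n → Hom G (Discrete n)
    constant j = toHom {G} {Discrete n} (λ _ → j) (λ _ → refl)
    constant-on-G : ∀ (φ : Hom G (Discrete n)) x → ⟦ φ ⟧ x₀ ≡ ⟦ φ ⟧ x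
    constant-on-G φ x = connected-transport conn (λ y → ⟦ φ ⟧ x₀ ≟ ⟦ φ ⟧ y)
      (λ y → mk⇔ (λ e → trans e (⟦⟧-commute φ y)) (λ e → trans e (sym (⟦⟧-commute φ y)))) refl

module _ {N : ℕ} (f : Fin N → Fin N) where

  eventually-periodic : ∀ y → ∃ λ p → 0 < p × p ≤ N × iterate f p (iterate f N y) ≡ iterate f N y
  eventually-periodic y with pigeonhole (n<1+n N) (λ (i : Fin (suc N)) → iterate f (toℕ i) y)
  ... | i , j , i<j , fⁱy≡fʲy = p , m<n⇒0<n∸m i<j , ≤-trans (m∸n≤m (toℕ j) (toℕ i)) (≤-pred (toℕ<n j)) , (begin
    iterate f p (iterate f N y)                    ≡⟨ cong (iterate f p) (iterate-split f y i≤N) ⟩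
    iterate f p (iterate f (N ∸ toℕ i) (fⁱ y))     ≡⟨ iterate-comm f p (N ∸ toℕ i) _ ⟩
    iterate f (N ∸ toℕ i) (iterate f p (fⁱ y))     ≡⟨ cong (iterate f (N ∸ toℕ i)) (iterate-split f y (<⇒≤ i<j)) ⟨
    iterate f (N ∸ toℕ i) (iterate f (toℕ j) y)    ≡⟨ cong (iterate f (N ∸ toℕ i)) fⁱy≡fʲy ⟨
    iterate f (N ∸ toℕ i) (fⁱ y)                   ≡⟨ iterate-split f y i≤N ⟨
    iterate f N y                                  ∎)
    where
    open ≡-Reasoning
    p = toℕ j ∸ toℕ i
    fⁱ = iterate f (toℕ i)
    i≤N : toℕ i ≤ N
    i≤N = ≤-pred (toℕ<n i)

  minimal-period : ∀ z → (∃ λ p → 0 < p × p ≤ N × iterate f p z ≡ z) →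
                   ∃ λ k → suc k ≤ N × iterate f (suc k) z ≡ z × ∀ e → 0 < e → e < suc k → iterate f e z ≢ z
  minimal-period z (suc p , _ , p<N , periodic)
    with minimum (λ e → iterate f (suc (toℕ e)) z ≟ z) (fromℕ< p<N , periodic')
    where periodic' = subst (λ e → iterate f (suc e) z ≡ z) (sym (toℕ-fromℕ< p<N)) periodic
  ... | e , periodic-e , e-minimal = toℕ e , toℕ<n e , periodic-e , shorter
    where
    shorter : ∀ e' → 0 < e' → e' < suc (toℕ e) → iterate f e' z ≢ z
    shorter (suc e') _ e'<e periodic-e' = <⇒≱ (≤-pred e'<e) (subst (toℕ e ≤_) (toℕ-fromℕ< e'<N)
      (e-minimal (fromℕ< e'<N) (subst (λ a → iterate f (suc a) z ≡ z) (sym (toℕ-fromℕ< e'<N)) periodic-e')))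
      where
      e'<N : e' < N
      e'<N = <-trans (≤-pred e'<e) (toℕ<n e)

module Orbit {N} (f : Fin N → Fin N) (z : Fin N) (k : ℕ) (period : iterate f (suc k) z ≡ z)
             (minimal : ∀ e → 0 < e → e < suc k → iterate f e z ≢ z) where

  point : Fin (suc k) → Fin N
  point j = iterate f (toℕ j) z

  point-rotate : ∀ j → point (rotate j) ≡ f (point j)
  point-rotate j =
    trans (cong (λ a → iterate f a z) (toℕ-rotate j)) (sym (iterate-mod f (suc k) period (suc (toℕ j))))

  distinct-below-period : ∀ {a b} → a < b → b < suc k → iterate f a z ≢ iterate f b z
  distinct-below-period {a} {b} a<b b<d fᵃz≡fᵇz = minimal (suc k ∸ b + a)
    (≤-trans (m<n⇒0<n∸m b<d) (m≤m+n (suc k ∸ b) a))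
    (subst (suc k ∸ b + a <_) (m∸n+n≡m (<⇒≤ b<d)) (+-monoʳ-< (suc k ∸ b) a<b))
    (begin
      iterate f (suc k ∸ b + a) z            ≡⟨ iterate-+ f (suc k ∸ b) a z ⟩
      iterate f (suc k ∸ b) (iterate f a z)  ≡⟨ cong (iterate f (suc k ∸ b)) fᵃz≡fᵇz ⟩
      iterate f (suc k ∸ b) (iterate f b z)  ≡⟨ iterate-split f z (<⇒≤ b<d) ⟨
      iterate f (suc k) z                    ≡⟨ period ⟩
      z                                      ∎)
    where open ≡-Reasoning

  point-injective : Injective _≡_ _≡_ point
  point-injective {i} {j} fⁱz≡fʲz with <-cmp (toℕ i) (toℕ j)
  ... | tri< i<j _ _ = contradiction fⁱz≡fʲz (distinct-below-period i<j (toℕ<n j))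
  ... | tri≈ _ i≡j _ = toℕ-injective i≡j
  ... | tri> _ _ j<i = contradiction (sym fⁱz≡fʲz) (distinct-below-period j<i (toℕ<n i))

  OnOrbit : Fin N → Set
  OnOrbit y = ∃ λ j → point j ≡ y

  onOrbit? : ∀ y → Dec (OnOrbit y)
  onOrbit? y = any? (λ j → point j ≟ y)

  OnOrbit-step : ∀ {y} → OnOrbit y → OnOrbit (f y)
  OnOrbit-step (j , point-j≡y) = rotate j , trans (point-rotate j) (cong f point-j≡y)

  OnOrbit-iterate : ∀ {y} n → OnOrbit y → OnOrbit (iterate f n y)
  OnOrbit-iterate zero    on = on
  OnOrbit-iterate (suc n) on = OnOrbit-step (OnOrbit-iterate n on)

-- The orbit of z = settle (h x₀) is a cycle in A, and every settle (h x) lies on it since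
-- G is connected; the position on the orbit is a homomorphism G → Cycle k.
module CycleLemma {A G : FDDS} (¬fixed : ¬ HasFixedPoint A) (conn : Connected G) (x₀ : Fin (size G))
                  (h : Hom G A) where

  settle : Fin (size A) → Fin (size A)
  settle = iterate (step A) (size A)

  z : Fin (size A)
  z = settle (⟦ h ⟧ x₀)

  period-of-z = minimal-period (step A) z (eventually-periodic (step A) (⟦ h ⟧ x₀))
  k = proj₁ period-of-z
  period = proj₁ (proj₂ (proj₂ period-of-z))

  open Orbit (step A) z k period (proj₂ (proj₂ (proj₂ period-of-z)))

  OnOrbit-settle⁻¹ : ∀ y → OnOrbit (step A (settle y)) → OnOrbit (settle y)
  OnOrbit-settle⁻¹ y on with eventually-periodic (step A) y
  ... | suc q , _ , _ , recurrent =
    subst OnOrbit (trans (iterate-commute (step A) q (settle y)) recurrent) (OnOrbit-iterate q on)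

  settle-step : ∀ x → settle (⟦ h ⟧ (step G x)) ≡ step A (settle (⟦ h ⟧ x))
  settle-step x = trans (cong settle (⟦⟧-commute h x)) (iterate-commute (step A) (size A) (⟦ h ⟧ x))

  on-orbit : ∀ x → OnOrbit (settle (⟦ h ⟧ x))
  on-orbit x = connected-transport conn (onOrbit? ∘ settle ∘ ⟦ h ⟧) invariant (zero , refl)
    where
    invariant : ∀ y → OnOrbit (settle (⟦ h ⟧ (step G y))) ⇔ OnOrbit (settle (⟦ h ⟧ y))
    invariant y = mk⇔ (λ on → OnOrbit-settle⁻¹ _ (subst OnOrbit (settle-step y) on))
                      (λ on → subst OnOrbit (sym (settle-step y)) (OnOrbit-step on))

  index : Fin (size G) → Fin (suc k)
  index = proj₁ ∘ on-orbit

  index-commute : ∀ x → index (step G x) ≡ rotate (index x)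
  index-commute x = point-injective (begin
    point (index (step G x))   ≡⟨ proj₂ (on-orbit (step G x)) ⟩
    settle (⟦ h ⟧ (step G x))  ≡⟨ settle-step x ⟩
    step A (settle (⟦ h ⟧ x))  ≡⟨ cong (step A) (proj₂ (on-orbit x)) ⟨
    step A (point (index x))   ≡⟨ point-rotate (index x) ⟨
    point (rotate (index x))   ∎)
    where open ≡-Reasoning

  k>0 : 0 < k
  k>0 = n≢0⇒n>0 λ k≡0 → ¬fixed (z , subst (λ n → iterate (step A) (suc n) z ≡ z) k≡0 period)

hom⇒hom-Cycle : ∀ {A G} → ¬ HasFixedPoint A → Connected G → Fin (size G) → Hom G A →
                ∃ λ k → 0 < k × suc k ≤ size A × Hom G (Cycle k)
hom⇒hom-Cycle {A} {G} ¬fixed conn x₀ h =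
  k , k>0 , proj₁ (proj₂ period-of-z) , toHom {G} {Cycle k} index index-commute
  where open CycleLemma ¬fixed conn x₀ h

-- Fixed-point-free coefficients

-- Formally twin₁ j − twin₂ j = ∏_{k=1}^{j} (Cycle k − Discrete (k + 1)).
twins : ℕ → FDDS × FDDS
twins zero    = 𝟙 , 𝟘
twins (suc j) = X ⊗ C ⊕ Y ⊗ D , Y ⊗ C ⊕ X ⊗ D
  where
  X = proj₁ (twins j)
  Y = proj₂ (twins j)
  C = Cycle (suc j)
  D = Discrete (suc (suc j))

twin₁ twin₂ : ℕ → FDDS
twin₁ = proj₁ ∘ twins
twin₂ = proj₂ ∘ twins

hom-⊗⊕⊗ : ∀ G → Connected G → Fin (size G) → ∀ U V C D →
          hom G (U ⊗ C ⊕ V ⊗ D) ≡ hom G U * hom G C + hom G V * hom G D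
hom-⊗⊕⊗ G conn x₀ U V C D =
  trans (hom-⊕ʳ G (U ⊗ C) (V ⊗ D) conn x₀) (cong₂ _+_ (hom-⊗ G U C) (hom-⊗ G V D))

twins-hom≡ : ∀ G → Connected G → Fin (size G) → ∀ {k} → 0 < k → Hom G (Cycle k) →
             ∀ j → k ≤ j → hom G (twin₁ j) ≡ hom G (twin₂ j)
twins-hom≡ G conn x₀     k>0 φ zero    k≤0   = contradiction k≤0 (<⇒≱ k>0)
twins-hom≡ G conn x₀ {k} k>0 φ (suc j) k≤1+j = begin
  hom G (twin₁ (suc j))  ≡⟨ hom-⊗⊕⊗ G conn x₀ (twin₁ j) (twin₂ j) C D ⟩
  x * c + y * d          ≡⟨ swap (m≤n⇒m<n∨m≡n k≤1+j) ⟩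
  y * c + x * d          ≡⟨ hom-⊗⊕⊗ G conn x₀ (twin₂ j) (twin₁ j) C D ⟨
  hom G (twin₂ (suc j))  ∎
  where
  open ≡-Reasoning
  C = Cycle (suc j)
  D = Discrete (suc (suc j))
  x = hom G (twin₁ j)
  y = hom G (twin₂ j)
  c = hom G C
  d = hom G D
  swap : k < suc j ⊎ k ≡ suc j → x * c + y * d ≡ y * c + x * d
  swap (inj₁ k<1+j) = cong₂ (λ a b → a * c + b * d) x≡y (sym x≡y)
    where x≡y = twins-hom≡ G conn x₀ k>0 φ j (≤-pred k<1+j)
  swap (inj₂ refl) = begin
    x * c + y * d  ≡⟨ cong (λ a → x * c + y * a) c≡d ⟨
    x * c + y * c  ≡⟨ +-comm (x * c) (y * c) ⟩
    y * c + x * c  ≡⟨ cong (λ a → y * c + x * a) c≡d ⟩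
    y * c + x * d  ∎
    where c≡d = trans (hom-Cycle conn x₀ φ) (sym (hom-Discrete conn x₀ (suc (suc j))))

𝟙-connected : Connected 𝟙
𝟙-connected c _ zero zero = refl

hom-𝟙-twins : ∀ j → hom 𝟙 (twin₁ j) ≢ hom 𝟙 (twin₂ j)
hom-𝟙-twins zero 1≡0 with () ← trans (sym (hom-𝟙 𝟙)) (trans 1≡0 (hom-𝟘 𝟙 zero))
hom-𝟙-twins (suc j) twins≡ =
  hom-𝟙-twins j (sym (*-cancelʳ-≡ (hom 𝟙 (twin₂ j)) (hom 𝟙 (twin₁ j)) (suc (suc j)) (begin
    hom 𝟙 (twin₂ j) * suc (suc j)  ≡⟨ at-𝟙 (twin₁ j) (twin₂ j) ⟨
    hom 𝟙 (twin₁ (suc j))          ≡⟨ twins≡ ⟩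
    hom 𝟙 (twin₂ (suc j))          ≡⟨ at-𝟙 (twin₂ j) (twin₁ j) ⟩
    hom 𝟙 (twin₁ j) * suc (suc j)  ∎)))
  where
  open ≡-Reasoning
  C = Cycle (suc j)
  D = Discrete (suc (suc j))
  at-𝟙 : ∀ U V → hom 𝟙 (U ⊗ C ⊕ V ⊗ D) ≡ hom 𝟙 V * suc (suc j)
  at-𝟙 U V = begin
    hom 𝟙 (U ⊗ C ⊕ V ⊗ D)                  ≡⟨ hom-⊗⊕⊗ 𝟙 𝟙-connected zero U V C D ⟩
    hom 𝟙 U * hom 𝟙 C + hom 𝟙 V * hom 𝟙 D  ≡⟨ cong₂ (λ c d → hom 𝟙 U * c + hom 𝟙 V * d)
                                                     (hom-𝟙-fixedPointFree (rotate-fixedPointFree z<s))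
                                                     (hom-Discrete 𝟙-connected zero (suc (suc j))) ⟩
    hom 𝟙 U * 0 + hom 𝟙 V * suc (suc j)    ≡⟨ cong (_+ hom 𝟙 V * suc (suc j)) (*-zeroʳ (hom 𝟙 U)) ⟩
    hom 𝟙 V * suc (suc j)                  ∎

twins-≇ : ∀ j → ¬ (twin₁ j ≅ twin₂ j)
twins-≇ j twins≅ = hom-𝟙-twins j (hom-congʳ 𝟙 twins≅)

fixedPointFree⇒twins-hom≡ : ∀ {A} → ¬ HasFixedPoint A → ∀ G → Connected G → Fin (size G) →
                            0 < hom G A → ∀ j → size A ≤ j → hom G (twin₁ j) ≡ hom G (twin₂ j)
fixedPointFree⇒twins-hom≡ {A} ¬fixed G conn x₀ hom>0 j A≤j =
  twins-hom≡ G conn x₀ k>0 φ j (≤-trans (<⇒≤ k<A) A≤j)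
  where
  cycle = hom⇒hom-Cycle ¬fixed conn x₀ (card>0⇒inhabited (Hom-finite G A) hom>0)
  k>0 = proj₁ (proj₂ cycle)
  k<A = proj₁ (proj₂ (proj₂ cycle))
  φ = proj₂ (proj₂ (proj₂ cycle))

*-congˡ-if-pos : ∀ a {x y} → (0 < a → x ≡ y) → a * x ≡ a * y
*-congˡ-if-pos zero    _   = refl
*-congˡ-if-pos (suc a) x≡y = cong (suc a *_) (x≡y z<s)

cancelable⇒fixedPoint : ∀ {A} → Cancelable A → HasFixedPoint A
cancelable⇒fixedPoint {A} cancel with hasFixedPoint? A
... | yes fixed = fixed
... | no ¬fixed = ⊥-elim (twins-≇ j (cancel (twin₁ j) (twin₂ j) (hom≡-connected⇒≅ λ G conn x₀ → begin
  hom G (A ⊗ twin₁ j)        ≡⟨ hom-⊗ G A (twin₁ j) ⟩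
  hom G A * hom G (twin₁ j)  ≡⟨ *-congˡ-if-pos (hom G A) (λ hom>0 → hom≡ G conn x₀ hom>0) ⟩
  hom G A * hom G (twin₂ j)  ≡⟨ hom-⊗ G A (twin₂ j) ⟨
  hom G (A ⊗ twin₂ j)        ∎)))
  where
  open ≡-Reasoning
  j = size A
  hom≡ = λ G conn x₀ hom>0 → fixedPointFree⇒twins-hom≡ ¬fixed G conn x₀ hom>0 j ≤-refl

fixedPointFree⇒¬PolyInjective : ∀ m A → (∀ i → 0 < toℕ i → ¬ HasFixedPoint (A i)) → ¬ PolyInjective m A
fixedPointFree⇒¬PolyInjective m A ¬fixed injective =
  twins-≇ j (injective (twin₁ j) (twin₂ j) (hom≡-connected⇒≅ λ G conn x₀ → begin
    hom G (evalPoly m A (twin₁ j))                      ≡⟨ hom-evalPoly G conn x₀ m A (twin₁ j) ⟩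
    evalℕ m (λ i → hom G (A i)) (hom G (twin₁ j))       ≡⟨ sum-cong-≗ (λ i → term≡ (hom G (A i)) (toℕ i)
                                                             (λ i>0 hom>0 → hom≡ i i>0 G conn x₀ hom>0)) ⟩
    evalℕ m (λ i → hom G (A i)) (hom G (twin₂ j))       ≡⟨ hom-evalPoly G conn x₀ m A (twin₂ j) ⟨
    hom G (evalPoly m A (twin₂ j))                      ∎))
  where
  open ≡-Reasoning
  j = sum (size ∘ A)
  hom≡ = λ i i>0 G conn x₀ hom>0 →
    fixedPointFree⇒twins-hom≡ (¬fixed i i>0) G conn x₀ hom>0 j (≤-sum (size ∘ A) i)
  term≡ : ∀ a t {x y} → (0 < t → 0 < a → x ≡ y) → a * x ℕ.^ t ≡ a * y ℕ.^ t
  term≡ a zero    _   = refl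
  term≡ a (suc t) x≡y = *-congˡ-if-pos a λ a>0 → cong (ℕ._^ suc t) (x≡y z<s a>0)

theorem3 : (m : ℕ) (A : Fin (suc m) → FDDS) →
    PolyInjective m A ⇔ Σ (Fin (suc m)) (λ i → (toℕ i ≥ 1) × Cancelable (A i))
theorem3 m A = mk⇔ forward backward
  where
  forward : PolyInjective m A → Σ (Fin (suc m)) (λ i → (toℕ i ≥ 1) × Cancelable (A i))
  forward injective with any? (λ i → (0 <? toℕ i) ×-dec hasFixedPoint? (A i))
  ... | yes (i , i>0 , fixed) = i , i>0 , fixedPoint⇒cancelable fixed
  ... | no ¬fixed = ⊥-elim (fixedPointFree⇒¬PolyInjective m A (λ i i>0 fixed → ¬fixed (i , i>0 , fixed)) injective)

  backward : Σ (Fin (suc m)) (λ i → (toℕ i ≥ 1) × Cancelable (A i)) → PolyInjective m A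
  backward (i , i>0 , cancelable) = fixedPoint⇒evalPoly-injective m A i i>0 (cancelable⇒fixedPoint cancelable)
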